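{- The sub-operad $\mathcal{BWS}$ of $\mathcal{BWTS}$ generated by the three trees (i) root labelled $\{2\}$ with one child labelled $\{1\}$, (ii) root labelled $\{1\}$ with one child labelled $\{2\}$, (iii) red empty root with two leaf children labelled $\{1\}$ and $\{2\}$, has as elements exactly the recursively labelled red and white trees in which no node carries more than one label and which avoid the two following patterns: no labelled node has a red child, and no white node has two (or more) red children.
   Context: A red and white tree of weight $n$: rooted tree with unordered children, each node carrying a (possibly empty) set of labels, label sets disjoint with union $\{1,\dots,n\}$, empty nodes having at least two children; labelled nodes are white, an empty node is red iff all its children are white (white otherwise). It is recursively labelled if for every node the set of labels in its subtree is an interval of $\{1,\dots,n\}$. Composition $T_1\circ_xT_2$ ($T_2$ of weight $k$, $x$ a label of $T_1$ in node $z$): relabel $y>x$ in $T_1$ as $y+k-1$, add $x-1$ to labels of $T_2$; (W) root of $T_2$ not red: erase $x$ from $z$, add root labels of $T_2$ to $z$, make root's children children of $z$; (R1) root of $T_2$ red and $T_1$ the one-node tree $\{x\}$: result $T_2$; (R2) root of $T_2$ red and $z$ not a leaf or with at least two labels: remove $x$ from $z$, attach root of $T_2$ as child of $z$; (R3) root of $T_2$ red and $z$ a non-root leaf with sole label $x$: delete $z$, make children of root of $T_2$ children of the parent of $z$; $z$ is white if it ends without labels. $\mathcal{BWTS}$ is the set-operad (unit: one-node tree $\{1\}$) generated by the three trees above together with the one-node tree $\{1,2\}$. -}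

module Defs where

open import Data.Nat using (ℕ; zero; suc; _+_; _∸_; _≤_; _<ᵇ_; _≡ᵇ_; _≟_)
open import Data.Bool using (Bool; true; false; if_then_else_; not; _∧_; _∨_)
open import Data.List using (List; []; _∷_; _++_; length; map; upTo; filter)
open import Data.List.Relation.Unary.All using (All)
open import Data.List.Relation.Binary.Permutation.Propositional using (_↭_)
open import Data.List.Membership.Propositional using (_∈_)
open import Data.Product using (Σ; ∃; _×_; _,_)
open import Data.Sum using (_⊎_)
open import Relation.Nullary using (¬?)
open import Relation.Binary.PropositionalEquality using (_≡_)

-- Raw trees: a node carries a list of labels (read as a set) and a list
-- of children (read as an unordered collection).  Trees are compared up
-- to the isomorphism _≅_ below (permuting labels and children).

data Tree : Set where
  node : List ℕ → List Tree → Tree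

rootLabels : Tree → List ℕ
rootLabels (node L _) = L

children : Tree → List Tree
children (node _ cs) = cs

mutual
  labels : Tree → List ℕ
  labels (node L cs) = L ++ labelsF cs

  labelsF : List Tree → List ℕ
  labelsF [] = []
  labelsF (c ∷ cs) = labels c ++ labelsF cs

weight : Tree → ℕ
weight T = length (labels T)

mutual
  isRed : Tree → Bool
  isRed (node [] cs) = allWhite cs
  isRed (node (_ ∷ _) _) = false

  allWhite : List Tree → Bool
  allWhite [] = true
  allWhite (c ∷ cs) = not (isRed c) ∧ allWhite cs

redCount : List Tree → ℕ
redCount [] = 0
redCount (c ∷ cs) = if isRed c then suc (redCount cs) else redCount cs

mutual
  data _≅_ : Tree → Tree → Set where
    node≅ : ∀ {L L' cs cs'} → L ↭ L' → cs ≅F cs' → node L cs ≅ node L' cs'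

  data _≅F_ : List Tree → List Tree → Set where
    perm : ∀ {cs ds es} → cs ↭ ds → ds ≅P es → cs ≅F es

  data _≅P_ : List Tree → List Tree → Set where
    []  : [] ≅P []
    _∷_ : ∀ {a b as bs} → a ≅ b → as ≅P bs → (a ∷ as) ≅P (b ∷ bs)

data Every (P : Tree → Set) : Tree → Set where
  every : ∀ {L cs} → P (node L cs) → All (Every P) cs → Every P (node L cs)

oneTo : ℕ → List ℕ
oneTo n = map suc (upTo n)

EmptyHasTwoChildren : Tree → Set
EmptyHasTwoChildren (node L cs) = L ≡ [] → 2 ≤ length cs

IsRWTree : ℕ → Tree → Set
IsRWTree n T = (labels T ↭ oneTo n) × Every EmptyHasTwoChildren T

SubtreeInterval : Tree → Set
SubtreeInterval T = Σ ℕ λ a → Σ ℕ λ m → labels T ↭ map (a +_) (upTo m)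

RecursivelyLabelled : Tree → Set
RecursivelyLabelled T = Every SubtreeInterval T

AtMostOneLabel : Tree → Set
AtMostOneLabel (node L _) = length L ≤ 1

NoRedChildOfLabelled : Tree → Set
NoRedChildOfLabelled (node L cs) = L ≡ [] ⊎ All (λ c → isRed c ≡ false) cs

NoTwoRedChildrenOfWhite : Tree → Set
NoTwoRedChildrenOfWhite T = isRed T ≡ false → redCount (children T) ≤ 1

mapLabels : (ℕ → ℕ) → Tree → Tree
mapLabelsF : (ℕ → ℕ) → List Tree → List Tree
mapLabels f (node L cs) = node (map f L) (mapLabelsF f cs)
mapLabelsF f [] = []
mapLabelsF f (c ∷ cs) = mapLabels f c ∷ mapLabelsF f cs

memb : ℕ → List ℕ → Bool
memb x [] = false
memb x (y ∷ ys) = (y ≡ᵇ x) ∨ memb x ys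

remove : ℕ → List ℕ → List ℕ
remove x L = filter (λ y → ¬? (y ≟ x)) L

isSoleLeaf : ℕ → Tree → Bool
isSoleLeaf x (node (y ∷ []) []) = y ≡ᵇ x
isSoleLeaf x _ = false

module _ (x : ℕ) where
  -- case (W): merge the root of S (labels R, children D) into node z ∋ x
  mutual
    substW : List ℕ → List Tree → Tree → Tree
    substW R D (node L cs) =
      if memb x L then node (remove x L ++ R) (cs ++ D)
      else node L (substWF R D cs)

    substWF : List ℕ → List Tree → List Tree → List Tree
    substWF R D [] = []
    substWF R D (c ∷ cs) = substW R D c ∷ substWF R D cs

  -- cases (R2)/(R3): S has a red root
  mutual
    substR : Tree → Tree → Tree
    substR S (node L cs) =
      if memb x L then node (remove x L) (cs ++ (S ∷ []))
      else node L (substRF S cs)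

    substRF : Tree → List Tree → List Tree
    substRF S [] = []
    substRF S (c ∷ cs) =
      if isSoleLeaf x c then children S ++ substRF S cs
      else substR S c ∷ substRF S cs

compose : Tree → ℕ → Tree → Tree
compose T₁ x T₂ =
  if isRed T₂
  then (if isSoleLeaf x T₁ then S else substR x S T₁')
  else substW x (rootLabels S) (children S) T₁'
  where
    k : ℕ
    k = weight T₂
    T₁' : Tree
    T₁' = mapLabels (λ y → if x <ᵇ y then y + k ∸ 1 else y) T₁
    S : Tree
    S = mapLabels (λ y → y + (x ∸ 1)) T₂

leaf : ℕ → Tree
leaf i = node (i ∷ []) []

data InBWS : Tree → Set where
  unit : InBWS (leaf 1)
  gen₁ : InBWS (node (2 ∷ []) (leaf 1 ∷ []))
  gen₂ : InBWS (node (1 ∷ []) (leaf 2 ∷ []))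
  gen₃ : InBWS (node [] (leaf 1 ∷ leaf 2 ∷ []))
  comp : ∀ {T₁ T₂ x} → InBWS T₁ → InBWS T₂ → x ∈ labels T₁ → InBWS (compose T₁ x T₂)
  iso  : ∀ {T T'} → InBWS T → T ≅ T' → InBWS T'

-- Label sets are handled through multiplicities: the labels of a subtree form the interval
-- [a, a + m) exactly when their multiplicity function is the indicator χ a m.
--
-- Soundness: the generators satisfy all conditions, and T₁ ∘ₓ T₂ replaces the single label x
-- of T₁ by a block [x, x + k] of k + 1 = weight T₂ consecutive labels while shifting the
-- labels above x by k, so every subtree still carries an interval.  In case (W) the node of
-- x, which has no red child, takes over the labels and children of the white root of T₂; in
-- case (R2) it loses its label and gets the red root of T₂ as its only red child; in case
-- (R3) the leaf x is replaced by the white children of that red root.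
--
-- Completeness, by induction on the weight n of a tree T satisfying the conditions: if some
-- child c of the root has weight k + 1 ≥ 2, its labels form a block [x, x + k]; contracting c
-- to x (to a leaf x if c is white, to a label x at the root if c is red, in which case the
-- root is unlabelled and c is its only red child) gives T₁ of weight n - k, and c relabelled
-- to [1, k + 1] gives T₂ of weight k + 1 < n, with T₁ ∘ₓ T₂ ≅ T.  Otherwise T is a corolla:
-- a red one is iterated composition of (iii), a labelled one is built from the leaf by (i), (ii).

module Submission where

open import Defs
open import Algebra.Bundles using (CommutativeMonoid)
open import Algebra.Properties.CommutativeSemigroup using (x∙yz≈y∙xz; xy∙z≈xz∙y)
open import Data.Bool using (Bool; true; false; not; _∧_; _∨_; if_then_else_; T)
open import Data.Bool.Properties using (∧-assoc; ∧-zeroʳ; ∧-commutativeMonoid)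
open import Data.Empty using (⊥; ⊥-elim)
open import Data.List using (List; []; _∷_; _++_; map; length; upTo; applyUpTo)
open import Data.List.Membership.Propositional using (_∈_)
open import Data.List.Membership.Propositional.Properties using (∈-∃++)
open import Data.List.Properties using (map-++; map-∘; map-id; length-map; length-++; ++-assoc; ++-identityʳ; map-cong-local; map-id-local; map-applyUpTo; ∷-injective)
open import Data.List.Relation.Binary.Permutation.Propositional as ↭ using (_↭_; prep; swap; ↭-sym; ↭-trans; ↭-refl; ↭-reflexive)
open import Data.List.Relation.Binary.Permutation.Propositional.Properties using (↭-length; ↭-empty-inv; All-resp-↭; ∷↭∷ʳ; ++⁺ˡ; map⁺; shift; shifts) renaming (++⁺ to ↭-++⁺)
open import Data.List.Relation.Unary.All as All using (All; []; _∷_)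
open import Data.List.Relation.Unary.All.Properties using (++⁺; ++⁻)
open import Data.List.Relation.Unary.Any using (here; there)
open import Data.Nat using (ℕ; zero; suc; _+_; _∸_; _≤_; _<_; z≤n; s≤s; _≟_; _≤?_; _<?_; _<ᵇ_; _≡ᵇ_)
open import Data.Nat.ListAction using (sum)
open import Data.Nat.ListAction.Properties using (sum-++; sum-↭)
open import Data.Nat.Properties
open import Data.Nat.Solver using (module +-*-Solver)
open import Data.Product using (Σ; ∃; _×_; _,_; proj₁; proj₂; uncurry)
open import Data.Sum using (_⊎_; inj₁; inj₂; [_,_]′)
open import Data.Unit using (tt)
open import Function using (_∘_; case_of_)
open import Function.Bundles using (_⇔_; mk⇔; Equivalence)
open import Relation.Binary using (tri<; tri≈; tri>)
open import Relation.Binary.PropositionalEquality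
open import Relation.Nullary using (yes; no; ¬_)

open +-*-Solver using (solve; _:+_; _:=_)

δ : ℕ → ℕ → ℕ
δ z y with z ≟ y
... | yes _ = 1
... | no _ = 0

δ-view : ∀ z y → (z ≡ y × δ z y ≡ 1) ⊎ (z ≢ y × δ z y ≡ 0)
δ-view z y with z ≟ y
... | yes z≡y = inj₁ (z≡y , refl)
... | no z≢y = inj₂ (z≢y , refl)

δ-refl : ∀ y → δ y y ≡ 1
δ-refl y with δ-view y y
... | inj₁ (_ , e) = e
... | inj₂ (y≢y , _) = ⊥-elim (y≢y refl)

δ-≢ : ∀ {z y} → z ≢ y → δ z y ≡ 0
δ-≢ {z} {y} z≢y with δ-view z y
... | inj₁ (z≡y , _) = ⊥-elim (z≢y z≡y)
... | inj₂ (_ , e) = e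

mult : ℕ → List ℕ → ℕ
mult y l = sum (map (λ z → δ z y) l)

mult-++ : ∀ y l l' → mult y (l ++ l') ≡ mult y l + mult y l'
mult-++ y l l' = trans (cong sum (map-++ (λ z → δ z y) l l')) (sum-++ (map (λ z → δ z y) l) _)

↭⇒mult : ∀ {l l'} → l ↭ l' → ∀ y → mult y l ≡ mult y l'
↭⇒mult p y = sum-↭ (map⁺ (λ z → δ z y) p)

mult-∷-self : ∀ z l → 0 < mult z (z ∷ l)
mult-∷-self z l rewrite δ-refl z = s≤s z≤n

mult-++ˡ : ∀ {y} l l' → 0 < mult y l → 0 < mult y (l ++ l')
mult-++ˡ {y} l l' p rewrite mult-++ y l l' = ≤-trans p (m≤m+n _ _)

mult-++ʳ : ∀ {y} l l' → 0 < mult y l' → 0 < mult y (l ++ l')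
mult-++ʳ {y} l l' p rewrite mult-++ y l l' = ≤-trans p (m≤n+m _ _)

∈⇒mult-pos : ∀ {y l} → y ∈ l → 0 < mult y l
∈⇒mult-pos {y} {z ∷ l} (here refl) = mult-∷-self y l
∈⇒mult-pos {y} {z ∷ l} (there p) = mult-++ʳ (z ∷ []) l (∈⇒mult-pos p)

mult-pos⇒∈ : ∀ {y l} → 0 < mult y l → y ∈ l
mult-pos⇒∈ {y} {z ∷ l} p with δ-view z y
... | inj₁ (refl , _) = here refl
... | inj₂ (_ , e) rewrite e = there (mult-pos⇒∈ p)

mult⇒↭ : ∀ l l' → (∀ y → mult y l ≡ mult y l') → l ↭ l'
mult⇒↭ [] [] _ = ↭-refl
mult⇒↭ [] (z ∷ l') eq with trans (eq z) (cong (_+ mult z l') (δ-refl z))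
... | ()
mult⇒↭ (z ∷ l) l' eq with ∈-∃++ {v = z} {xs = l'} (mult-pos⇒∈ (subst (0 <_) (eq z) (mult-∷-self z l)))
... | u , v , refl = ↭-trans (prep z (mult⇒↭ l (u ++ v) eq')) (↭-sym (shift z u v))
  where
  eq' : ∀ y → mult y l ≡ mult y (u ++ v)
  eq' y = +-cancelˡ-≡ (δ z y) _ _ (begin
    δ z y + mult y l            ≡⟨ eq y ⟩
    mult y (u ++ z ∷ v)         ≡⟨ mult-++ y u (z ∷ v) ⟩
    mult y u + (δ z y + mult y v) ≡⟨ x∙yz≈y∙xz +-commutativeSemigroup (mult y u) (δ z y) (mult y v) ⟩
    δ z y + (mult y u + mult y v) ≡⟨ cong (δ z y +_) (sym (mult-++ y u v)) ⟩
    δ z y + mult y (u ++ v)     ∎)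
    where open ≡-Reasoning

χ : ℕ → ℕ → ℕ → ℕ
χ a m y with a ≤? y | y <? a + m
... | yes _ | yes _ = 1
... | _ | _ = 0

χ-view : ∀ a m y → (a ≤ y × y < a + m × χ a m y ≡ 1) ⊎ ((y < a ⊎ a + m ≤ y) × χ a m y ≡ 0)
χ-view a m y with a ≤? y | y <? a + m
... | yes a≤y | yes y<a+m = inj₁ (a≤y , y<a+m , refl)
... | yes _ | no y≮a+m = inj₂ (inj₂ (≮⇒≥ y≮a+m) , refl)
... | no a≰y | _ = inj₂ (inj₁ (≰⇒> a≰y) , refl)

χ-inside : ∀ {a m y} → a ≤ y → y < a + m → χ a m y ≡ 1
χ-inside {a} {m} {y} a≤y y<a+m with χ-view a m y
... | inj₁ (_ , _ , e) = e
... | inj₂ (inj₁ y<a , _) = ⊥-elim (<⇒≱ y<a a≤y)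
... | inj₂ (inj₂ a+m≤y , _) = ⊥-elim (<⇒≱ y<a+m a+m≤y)

χ-below : ∀ {a m y} → y < a → χ a m y ≡ 0
χ-below {a} {m} {y} y<a with χ-view a m y
... | inj₁ (a≤y , _ , _) = ⊥-elim (<⇒≱ y<a a≤y)
... | inj₂ (_ , e) = e

χ-above : ∀ {a m y} → a + m ≤ y → χ a m y ≡ 0
χ-above {a} {m} {y} a+m≤y with χ-view a m y
... | inj₁ (_ , y<a+m , _) = ⊥-elim (<⇒≱ y<a+m a+m≤y)
... | inj₂ (_ , e) = e

χ-pos⇒inside : ∀ {a m y} → 0 < χ a m y → a ≤ y × y < a + m
χ-pos⇒inside {a} {m} {y} pos with χ-view a m y
... | inj₁ (a≤y , y<a+m , _) = a≤y , y<a+m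
... | inj₂ (_ , e) rewrite e = ⊥-elim (<-irrefl refl pos)

χ-pos⇒1 : ∀ {a m y} → 0 < χ a m y → χ a m y ≡ 1
χ-pos⇒1 pos = uncurry χ-inside (χ-pos⇒inside pos)

χ-empty : ∀ a y → χ a 0 y ≡ 0
χ-empty a y with χ-view a 0 y
... | inj₁ (a≤y , y<a+0 , _) = ⊥-elim (<⇒≱ y<a+0 (subst (_≤ y) (sym (+-identityʳ a)) a≤y))
... | inj₂ (_ , e) = e

χ≤1 : ∀ a m y → χ a m y ≤ 1
χ≤1 a m y with χ-view a m y
... | inj₁ (_ , _ , e) = ≤-reflexive e
... | inj₂ (_ , e) = subst (_≤ 1) (sym e) z≤n

χ-resize : ∀ {a m m' y} → y < a + m → y < a + m' → χ a m y ≡ χ a m' y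
χ-resize {a} {m} {m'} {y} y<a+m y<a+m' with χ-view a m y
... | inj₁ (a≤y , _ , e) = trans e (sym (χ-inside a≤y y<a+m'))
... | inj₂ (inj₁ y<a , e) = trans e (sym (χ-below y<a))
... | inj₂ (inj₂ a+m≤y , _) = ⊥-elim (<⇒≱ y<a+m a+m≤y)

χ-stretch : ∀ {a m w k} → a ≤ w → χ a m w ≡ χ a (m + k) (w + k)
χ-stretch {a} {m} {w} {k} a≤w with χ-view a m w | χ-view a (m + k) (w + k)
... | inj₁ (_ , _ , e₁) | inj₁ (_ , _ , e₂) = trans e₁ (sym e₂)
... | inj₂ (_ , e₁) | inj₂ (_ , e₂) = trans e₁ (sym e₂)
... | inj₁ _ | inj₂ (inj₁ r , _) = ⊥-elim (<⇒≱ r (≤-trans a≤w (m≤m+n w k)))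
... | inj₁ (_ , q , _) | inj₂ (inj₂ r , _) = ⊥-elim (<⇒≱ q (+-cancelʳ-≤ k (a + m) w (subst (_≤ w + k) (sym (+-assoc a m k)) r)))
... | inj₂ (inj₁ r , _) | inj₁ _ = ⊥-elim (<⇒≱ r a≤w)
... | inj₂ (inj₂ r , _) | inj₁ (_ , q , _) = ⊥-elim (<⇒≱ q (subst (_≤ w + k) (+-assoc a m k) (+-monoˡ-≤ k r)))

χ-translate : ∀ {a m w} p → χ a m w ≡ χ (a + p) m (w + p)
χ-translate {a} {m} {w} p with χ-view a m w
... | inj₁ (a≤w , w<a+m , e) = trans e (sym (χ-inside (+-monoˡ-≤ p a≤w) w+p<a+p+m))
  where
  w+p<a+p+m : w + p < a + p + m
  w+p<a+p+m = subst (w + p <_) (xy∙z≈xz∙y +-commutativeSemigroup a m p) (+-monoˡ-< p w<a+m)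
... | inj₂ (inj₁ w<a , e) = trans e (sym (χ-below (+-monoˡ-< p w<a)))
... | inj₂ (inj₂ a+m≤w , e) = trans e (sym (χ-above a+p+m≤w+p))
  where
  a+p+m≤w+p : a + p + m ≤ w + p
  a+p+m≤w+p = subst (_≤ w + p) (xy∙z≈xz∙y +-commutativeSemigroup a m p) (+-monoˡ-≤ p a+m≤w)

χ-shift : ∀ {a a' m w z} p q → a' + q ≡ a + p → z + q ≡ w + p → χ a m w ≡ χ a' m z
χ-shift {a} {a'} {m} {w} {z} p q a'+q≡a+p z+q≡w+p = begin
  χ a m w                 ≡⟨ χ-translate p ⟩
  χ (a + p) m (w + p)     ≡⟨ cong₂ (λ b v → χ b m v) (sym a'+q≡a+p) (sym z+q≡w+p) ⟩
  χ (a' + q) m (z + q)    ≡⟨ sym (χ-translate q) ⟩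
  χ a' m z                ∎
  where open ≡-Reasoning

range : ℕ → ℕ → List ℕ
range a zero = []
range a (suc m) = a ∷ range (suc a) m

applyUpTo-range : ∀ (f : ℕ → ℕ) a m → (∀ i → f i ≡ a + i) → applyUpTo f m ≡ range a m
applyUpTo-range f a zero _ = refl
applyUpTo-range f a (suc m) f≗a+ =
  cong₂ _∷_ (trans (f≗a+ 0) (+-identityʳ a))
            (applyUpTo-range (f ∘ suc) (suc a) m (λ i → trans (f≗a+ (suc i)) (+-suc a i)))

map-+-upTo : ∀ a m → map (a +_) (upTo m) ≡ range a m
map-+-upTo a m = trans (map-applyUpTo (λ i → i) (a +_) m) (applyUpTo-range (a +_) a m (λ _ → refl))

mult-range : ∀ y a m → mult y (range a m) ≡ χ a m y
mult-range y a zero = sym (χ-empty a y)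
mult-range y a (suc m) with δ-view a y
... | inj₁ (refl , e) = begin
  δ a a + mult a (range (suc a) m) ≡⟨ cong₂ _+_ e (mult-range a (suc a) m) ⟩
  1 + χ (suc a) m a                ≡⟨ cong suc (χ-below (n<1+n a)) ⟩
  1                                ≡⟨ sym (χ-inside ≤-refl (m<m+n a (s≤s z≤n))) ⟩
  χ a (suc m) a                    ∎
  where open ≡-Reasoning
... | inj₂ (a≢y , e) = trans (cong₂ _+_ e (mult-range y (suc a) m)) (χ-step (χ-view (suc a) m y) (χ-view a (suc m) y))
  where
  χ-step : _ → _ → χ (suc a) m y ≡ χ a (suc m) y
  χ-step (inj₁ (_ , _ , e₁)) (inj₁ (_ , _ , e₂)) = trans e₁ (sym e₂)
  χ-step (inj₂ (_ , e₁)) (inj₂ (_ , e₂)) = trans e₁ (sym e₂)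
  χ-step (inj₁ (a<y , _ , _)) (inj₂ (inj₁ y<a , _)) = ⊥-elim (<⇒≱ y<a (<⇒≤ a<y))
  χ-step (inj₁ (_ , y<sa+m , _)) (inj₂ (inj₂ a+sm≤y , _)) = ⊥-elim (<⇒≱ y<sa+m (subst (_≤ y) (+-suc a m) a+sm≤y))
  χ-step (inj₂ (inj₁ y<sa , _)) (inj₁ (a≤y , _ , _)) = ⊥-elim (a≢y (≤-antisym a≤y (≤-pred y<sa)))
  χ-step (inj₂ (inj₂ sa+m≤y , _)) (inj₁ (_ , y<a+sm , _)) = ⊥-elim (<⇒≱ y<a+sm (subst (_≤ y) (sym (+-suc a m)) sa+m≤y))

range-∷ʳ : ∀ a m → range a (suc m) ≡ range a m ++ (a + m ∷ [])
range-∷ʳ a zero = cong (_∷ []) (sym (+-identityʳ a))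
range-∷ʳ a (suc m) = cong (a ∷_) (trans (range-∷ʳ (suc a) m) (cong (λ w → range (suc a) m ++ (w ∷ [])) (sym (+-suc a m))))

range-++ : ∀ a m m' → range a (m + m') ≡ range a m ++ range (a + m) m'
range-++ a zero m' = cong (λ w → range w m') (sym (+-identityʳ a))
range-++ a (suc m) m' = cong (a ∷_) (trans (range-++ (suc a) m m') (cong (λ w → range (suc a) m ++ range w m') (sym (+-suc a m))))

map-+-range : ∀ c a m → map (c +_) (range a m) ≡ range (c + a) m
map-+-range c a zero = refl
map-+-range c a (suc m) = cong (c + a ∷_) (trans (map-+-range c (suc a) m) (cong (λ w → range w m) (+-suc c a)))

length-range : ∀ a m → length (range a m) ≡ m
length-range a zero = refl
length-range a (suc m) = cong suc (length-range (suc a) m)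

range-bounds : ∀ a m → All (λ v → a ≤ v × v < a + m) (range a m)
range-bounds a zero = []
range-bounds a (suc m) = (≤-refl , subst (a <_) (sym (+-suc a m)) (s≤s (m≤m+n a m)))
  ∷ All.map (λ {v} (a<v , v<sa+m) → <⇒≤ a<v , subst (v <_) (sym (+-suc a m)) v<sa+m) (range-bounds (suc a) m)

occ : Tree → ℕ → ℕ
occ t y = mult y (labels t)

occF : List Tree → ℕ → ℕ
occF cs y = mult y (labelsF cs)

Spans : Tree → ℕ → ℕ → Set
Spans t a m = ∀ y → occ t y ≡ χ a m y

IsInterval : Tree → Set
IsInterval t = Σ ℕ λ a → Σ ℕ λ m → Spans t a m

occ-node : ∀ L cs y → occ (node L cs) y ≡ mult y L + occF cs y
occ-node L cs y = mult-++ y L (labelsF cs)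

occF-∷ : ∀ c cs y → occF (c ∷ cs) y ≡ occ c y + occF cs y
occF-∷ c cs y = mult-++ y (labels c) (labelsF cs)

labelsF-++ : ∀ cs ds → labelsF (cs ++ ds) ≡ labelsF cs ++ labelsF ds
labelsF-++ [] ds = refl
labelsF-++ (c ∷ cs) ds = trans (cong (labels c ++_) (labelsF-++ cs ds)) (sym (++-assoc (labels c) _ _))

occF-++ : ∀ y cs ds → occF (cs ++ ds) y ≡ occF cs y + occF ds y
occF-++ y cs ds rewrite labelsF-++ cs ds = mult-++ y (labelsF cs) (labelsF ds)

occF-head : ∀ {y} c cs → 0 < occ c y → 0 < occF (c ∷ cs) y
occF-head c cs = mult-++ˡ (labels c) (labelsF cs)

occF-tail : ∀ {y} c cs → 0 < occF cs y → 0 < occF (c ∷ cs) y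
occF-tail c cs = mult-++ʳ (labels c) (labelsF cs)

occ-children : ∀ {y} L cs → 0 < occF cs y → 0 < occ (node L cs) y
occ-children L cs = mult-++ʳ L (labelsF cs)

labelsF-leaves : ∀ l → labelsF (map leaf l) ≡ l
labelsF-leaves [] = refl
labelsF-leaves (v ∷ l) = cong (v ∷_) (labelsF-leaves l)

occ-leaf : ∀ x y → occ (leaf x) y ≡ δ x y
occ-leaf x y = +-identityʳ (δ x y)

Spans⇒↭ : ∀ t {a m} → Spans t a m → labels t ↭ range a m
Spans⇒↭ t {a} {m} I = mult⇒↭ (labels t) (range a m) (λ y → trans (I y) (sym (mult-range y a m)))

↭⇒Spans : ∀ t {a m} → labels t ↭ range a m → Spans t a m
↭⇒Spans t {a} {m} p y = trans (↭⇒mult p y) (mult-range y a m)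

weight-Spans : ∀ t {a m} → Spans t a m → weight t ≡ m
weight-Spans t {a} {m} I = trans (↭-length (Spans⇒↭ t I)) (length-range a m)

SubtreeInterval⇔IsInterval : ∀ t → SubtreeInterval t ⇔ IsInterval t
SubtreeInterval⇔IsInterval t = mk⇔
  (λ (a , m , p) → a , m , ↭⇒Spans t (subst (labels t ↭_) (map-+-upTo a m) p))
  (λ (a , m , I) → a , m , subst (labels t ↭_) (sym (map-+-upTo a m)) (Spans⇒↭ t I))

mapLabelsF-++ : ∀ h cs ds → mapLabelsF h (cs ++ ds) ≡ mapLabelsF h cs ++ mapLabelsF h ds
mapLabelsF-++ h [] ds = refl
mapLabelsF-++ h (c ∷ cs) ds = cong (mapLabels h c ∷_) (mapLabelsF-++ h cs ds)

mapLabelsF-leaves : ∀ h l → mapLabelsF h (map leaf l) ≡ map leaf (map h l)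
mapLabelsF-leaves h [] = refl
mapLabelsF-leaves h (v ∷ l) = cong (leaf (h v) ∷_) (mapLabelsF-leaves h l)

length-mapLabelsF : ∀ h cs → length (mapLabelsF h cs) ≡ length cs
length-mapLabelsF h [] = refl
length-mapLabelsF h (c ∷ cs) = cong suc (length-mapLabelsF h cs)

mutual
  labels-mapLabels : ∀ h t → labels (mapLabels h t) ≡ map h (labels t)
  labels-mapLabels h (node L cs) = trans (cong (map h L ++_) (labelsF-mapLabelsF h cs)) (sym (map-++ h L (labelsF cs)))

  labelsF-mapLabelsF : ∀ h cs → labelsF (mapLabelsF h cs) ≡ map h (labelsF cs)
  labelsF-mapLabelsF h [] = refl
  labelsF-mapLabelsF h (c ∷ cs) =
    trans (cong₂ _++_ (labels-mapLabels h c) (labelsF-mapLabelsF h cs)) (sym (map-++ h (labels c) (labelsF cs)))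

map-cong-mult : ∀ {h h' : ℕ → ℕ} l → (∀ y → 0 < mult y l → h y ≡ h' y) → map h l ≡ map h' l
map-cong-mult [] _ = refl
map-cong-mult (z ∷ l) h≗h' = cong₂ _∷_ (h≗h' z (mult-∷-self z l)) (map-cong-mult l (λ y p → h≗h' y (mult-++ʳ (z ∷ []) l p)))

mutual
  mapLabels-cong : ∀ {h h'} t → (∀ y → 0 < occ t y → h y ≡ h' y) → mapLabels h t ≡ mapLabels h' t
  mapLabels-cong (node L cs) h≗h' =
    cong₂ node (map-cong-mult L (λ y p → h≗h' y (mult-++ˡ L (labelsF cs) p)))
               (mapLabelsF-cong cs (λ y p → h≗h' y (occ-children L cs p)))

  mapLabelsF-cong : ∀ {h h'} cs → (∀ y → 0 < occF cs y → h y ≡ h' y) → mapLabelsF h cs ≡ mapLabelsF h' cs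
  mapLabelsF-cong [] _ = refl
  mapLabelsF-cong (c ∷ cs) h≗h' =
    cong₂ _∷_ (mapLabels-cong c (λ y p → h≗h' y (occF-head c cs p)))
              (mapLabelsF-cong cs (λ y p → h≗h' y (occF-tail c cs p)))

mutual
  mapLabels-∘ : ∀ h g t → mapLabels h (mapLabels g t) ≡ mapLabels (h ∘ g) t
  mapLabels-∘ h g (node L cs) = cong₂ node (sym (map-∘ L)) (mapLabelsF-∘ h g cs)

  mapLabelsF-∘ : ∀ h g cs → mapLabelsF h (mapLabelsF g cs) ≡ mapLabelsF (h ∘ g) cs
  mapLabelsF-∘ h g [] = refl
  mapLabelsF-∘ h g (c ∷ cs) = cong₂ _∷_ (mapLabels-∘ h g c) (mapLabelsF-∘ h g cs)

mutual
  mapLabels-id : ∀ t → mapLabels (λ y → y) t ≡ t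
  mapLabels-id (node L cs) = cong₂ node (map-id L) (mapLabelsF-id cs)

  mapLabelsF-id : ∀ cs → mapLabelsF (λ y → y) cs ≡ cs
  mapLabelsF-id [] = refl
  mapLabelsF-id (c ∷ cs) = cong₂ _∷_ (mapLabels-id c) (mapLabelsF-id cs)

mapLabels-id-on : ∀ h t → (∀ y → 0 < occ t y → h y ≡ y) → mapLabels h t ≡ t
mapLabels-id-on h t h≗id = trans (mapLabels-cong t h≗id) (mapLabels-id t)

mutual
  isRed-mapLabels : ∀ h t → isRed (mapLabels h t) ≡ isRed t
  isRed-mapLabels h (node [] cs) = allWhite-mapLabelsF h cs
  isRed-mapLabels h (node (_ ∷ _) cs) = refl

  allWhite-mapLabelsF : ∀ h cs → allWhite (mapLabelsF h cs) ≡ allWhite cs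
  allWhite-mapLabelsF h [] = refl
  allWhite-mapLabelsF h (c ∷ cs) = cong₂ (λ a b → not a ∧ b) (isRed-mapLabels h c) (allWhite-mapLabelsF h cs)

colours-mapLabelsF : ∀ h cs → map isRed (mapLabelsF h cs) ≡ map isRed cs
colours-mapLabelsF h [] = refl
colours-mapLabelsF h (c ∷ cs) = cong₂ _∷_ (isRed-mapLabels h c) (colours-mapLabelsF h cs)

mult-map-hit : ∀ (h : ℕ → ℕ) {z w} l → h w ≡ z → (∀ v → 0 < mult v l → h v ≡ z → v ≡ w) → mult z (map h l) ≡ mult w l
mult-map-hit h [] _ _ = refl
mult-map-hit h {z} {w} (u ∷ l) hw≡z inj with δ-view u w | δ-view (h u) z
... | inj₁ (refl , e₁) | inj₁ (_ , e₂) = cong₂ _+_ (trans e₂ (sym e₁)) (mult-map-hit h l hw≡z (λ v p → inj v (mult-++ʳ (u ∷ []) l p)))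
... | inj₁ (refl , _) | inj₂ (hu≢z , _) = ⊥-elim (hu≢z hw≡z)
... | inj₂ (u≢w , _) | inj₁ (hu≡z , _) = ⊥-elim (u≢w (inj u (mult-∷-self u l) hu≡z))
... | inj₂ (_ , e₁) | inj₂ (_ , e₂) = cong₂ _+_ (trans e₂ (sym e₁)) (mult-map-hit h l hw≡z (λ v p → inj v (mult-++ʳ (u ∷ []) l p)))

mult-map-miss : ∀ (h : ℕ → ℕ) {z} l → (∀ v → 0 < mult v l → h v ≢ z) → mult z (map h l) ≡ 0
mult-map-miss h [] _ = refl
mult-map-miss h {z} (u ∷ l) miss with δ-view (h u) z
... | inj₁ (hu≡z , _) = ⊥-elim (miss u (mult-∷-self u l) hu≡z)
... | inj₂ (_ , e) = cong₂ _+_ e (mult-map-miss h l (λ v p → miss v (mult-++ʳ (u ∷ []) l p)))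

occ-mapLabels-hit : ∀ h {z w} t → h w ≡ z → (∀ v → 0 < occ t v → h v ≡ z → v ≡ w) → occ (mapLabels h t) z ≡ occ t w
occ-mapLabels-hit h t hw≡z inj rewrite labels-mapLabels h t = mult-map-hit h (labels t) hw≡z inj

occ-mapLabels-miss : ∀ h {z} t → (∀ v → 0 < occ t v → h v ≢ z) → occ (mapLabels h t) z ≡ 0
occ-mapLabels-miss h t miss rewrite labels-mapLabels h t = mult-map-miss h (labels t) miss

occ-mapLabels-fibre : ∀ h {z w} t → (0 < occ t w → h w ≡ z) → (∀ v → 0 < occ t v → h v ≡ z → v ≡ w)
                    → occ (mapLabels h t) z ≡ occ t w
occ-mapLabels-fibre h {z} {w} t hit inj with occ t w in e
... | zero = occ-mapLabels-miss h t (λ v p hv≡z → <-irrefl (sym e) (subst (λ u → 0 < occ t u) (inj v p hv≡z) p))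
... | suc _ = trans (occ-mapLabels-hit h t (hit (s≤s z≤n)) inj) e

Spans-mapLabels-empty : ∀ h t {a} a' → Spans t a 0 → Spans (mapLabels h t) a' 0
Spans-mapLabels-empty h t {a} a' I z =
  trans (occ-mapLabels-miss h t (λ v p _ → <-irrefl (sym (trans (I v) (χ-empty a v))) p)) (sym (χ-empty a' z))

-- h y + q ≡ y + p says that h translates the labels of t by p - q, avoiding truncated subtraction.
Spans-translate : ∀ h p q t {a m a'} → Spans t a m → (∀ y → 0 < occ t y → h y + q ≡ y + p) → a' + q ≡ a + p
                → Spans (mapLabels h t) a' m
Spans-translate h p q t {a} {m} {a'} I h-transl a'+q≡a+p z with p ≤? z + q
... | no p≰z+q = trans (occ-mapLabels-miss h t miss) (sym (χ-below z<a'))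
  where
  miss : ∀ v → 0 < occ t v → h v ≢ z
  miss v pv hv≡z = p≰z+q (subst (p ≤_) (trans (sym (h-transl v pv)) (cong (_+ q) hv≡z)) (m≤n+m p v))
  z<a' : z < a'
  z<a' = +-cancelʳ-< q z a' (subst (z + q <_) (sym a'+q≡a+p) (<-≤-trans (≰⇒> p≰z+q) (m≤n+m p a)))
... | yes p≤z+q = begin
  occ (mapLabels h t) z ≡⟨ occ-mapLabels-fibre h t hit inj ⟩
  occ t w               ≡⟨ I w ⟩
  χ a m w               ≡⟨ χ-shift p q a'+q≡a+p z+q≡w+p ⟩
  χ a' m z              ∎
  where
  open ≡-Reasoning
  w : ℕ
  w = z + q ∸ p
  z+q≡w+p : z + q ≡ w + p
  z+q≡w+p = sym (m∸n+n≡m p≤z+q)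
  hit : 0 < occ t w → h w ≡ z
  hit pw = +-cancelʳ-≡ q (h w) z (trans (h-transl w pw) (sym z+q≡w+p))
  inj : ∀ v → 0 < occ t v → h v ≡ z → v ≡ w
  inj v pv hv≡z = +-cancelʳ-≡ p v w (trans (sym (h-transl v pv)) (trans (cong (_+ q) hv≡z) z+q≡w+p))

IsInterval-translate : ∀ h p q t → IsInterval t → (∀ y → 0 < occ t y → h y + q ≡ y + p) → IsInterval (mapLabels h t)
IsInterval-translate h p q t (a , zero , I) _ = 0 , 0 , Spans-mapLabels-empty h t 0 I
IsInterval-translate h p q t (a , suc m , I) h-transl =
  h a , suc m , Spans-translate h p q t I h-transl (h-transl a a-label)
  where
  a-label : 0 < occ t a
  a-label = subst (0 <_) (sym (trans (I a) (χ-inside ≤-refl (m<m+n a (s≤s z≤n))))) (s≤s z≤n)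

record Good (t : Tree) : Set where
  constructor good
  field
    twoChildren    : EmptyHasTwoChildren t
    interval       : IsInterval t
    atMostOneLabel : AtMostOneLabel t
    noRedChild     : NoRedChildOfLabelled t
    atMostOneRed   : NoTwoRedChildrenOfWhite t
open Good

NotRed : Tree → Set
NotRed c = isRed c ≡ false

Every-root : ∀ {P t} → Every P t → P t
Every-root (every p _) = p

Every-children : ∀ {P L cs} → Every P (node L cs) → All (Every P) cs
Every-children (every _ ps) = ps

mutual
  Every-map : ∀ {P Q : Tree → Set} → (∀ {t} → P t → Q t) → ∀ {t} → Every P t → Every Q t
  Every-map f (every p ps) = every (f p) (Every-mapF f ps)

  Every-mapF : ∀ {P Q : Tree → Set} → (∀ {t} → P t → Q t) → ∀ {cs} → All (Every P) cs → All (Every Q) cs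
  Every-mapF f [] = []
  Every-mapF f (p ∷ ps) = Every-map f p ∷ Every-mapF f ps

mutual
  Every-zip : ∀ {P Q : Tree → Set} {t} → Every P t → Every Q t → Every (λ s → P s × Q s) t
  Every-zip (every p ps) (every q qs) = every (p , q) (Every-zipF ps qs)

  Every-zipF : ∀ {P Q : Tree → Set} {cs} → All (Every P) cs → All (Every Q) cs → All (Every (λ s → P s × Q s)) cs
  Every-zipF [] [] = []
  Every-zipF (p ∷ ps) (q ∷ qs) = Every-zip p q ∷ Every-zipF ps qs

allWhite-++ : ∀ cs ds → allWhite (cs ++ ds) ≡ allWhite cs ∧ allWhite ds
allWhite-++ [] ds = refl
allWhite-++ (c ∷ cs) ds rewrite allWhite-++ cs ds = sym (∧-assoc (not (isRed c)) (allWhite cs) (allWhite ds))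

redCount-++ : ∀ cs ds → redCount (cs ++ ds) ≡ redCount cs + redCount ds
redCount-++ [] ds = refl
redCount-++ (c ∷ cs) ds with isRed c
... | true = cong suc (redCount-++ cs ds)
... | false = redCount-++ cs ds

NotRed⇒redCount≡0 : ∀ {cs} → All NotRed cs → redCount cs ≡ 0
NotRed⇒redCount≡0 [] = refl
NotRed⇒redCount≡0 (p ∷ ps) rewrite p = NotRed⇒redCount≡0 ps

redCount≡0⇒NotRed : ∀ cs → redCount cs ≡ 0 → All NotRed cs
redCount≡0⇒NotRed [] _ = []
redCount≡0⇒NotRed (c ∷ cs) e with isRed c in ec
... | false = ec ∷ redCount≡0⇒NotRed cs e

allWhite⇒NotRed : ∀ cs → allWhite cs ≡ true → All NotRed cs
allWhite⇒NotRed [] _ = []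
allWhite⇒NotRed (c ∷ cs) e with isRed c in ec
... | false = ec ∷ allWhite⇒NotRed cs e

isRed-++ʳ : ∀ R cs {D} → isRed (node R D) ≡ false → isRed (node R (cs ++ D)) ≡ false
isRed-++ʳ [] cs {D} D-white = trans (allWhite-++ cs D) (trans (cong (allWhite cs ∧_) D-white) (∧-zeroʳ _))
isRed-++ʳ (_ ∷ _) _ _ = refl

red-child⇒¬All-NotRed : ∀ pre {c} post → isRed c ≡ true → ¬ All NotRed (pre ++ c ∷ post)
red-child⇒¬All-NotRed pre post c-red all-white with ++⁻ pre all-white
... | _ , c-white ∷ _ = case trans (sym c-white) c-red of λ ()

-- rs may replace cs as the children of a node without spoiling the node conditions
record ColoursCompatible (rs cs : List Tree) : Set where
  field
    allWhite≡ : allWhite rs ≡ allWhite cs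
    redCount≡ : redCount rs ≡ redCount cs
    NotRed⇒   : All NotRed cs → All NotRed rs
    length≥   : length cs ≤ length rs
open ColoursCompatible

Compatible-∷ : ∀ {r c rs cs} → isRed r ≡ isRed c → ColoursCompatible rs cs → ColoursCompatible (r ∷ rs) (c ∷ cs)
Compatible-∷ {r} {c} {rs} {cs} r≡c compat = record
  { allWhite≡ = cong₂ (λ a b → not a ∧ b) r≡c (allWhite≡ compat)
  ; redCount≡ = redCount-∷
  ; NotRed⇒ = λ { (p ∷ ps) → trans r≡c p ∷ NotRed⇒ compat ps }
  ; length≥ = s≤s (length≥ compat)
  }
  where
  redCount-∷ : redCount (r ∷ rs) ≡ redCount (c ∷ cs)
  redCount-∷ rewrite r≡c | redCount≡ compat = refl

SameColours⇒Compatible : ∀ rs cs → map isRed rs ≡ map isRed cs → ColoursCompatible rs cs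
SameColours⇒Compatible [] [] _ = record { allWhite≡ = refl ; redCount≡ = refl ; NotRed⇒ = λ _ → [] ; length≥ = z≤n }
SameColours⇒Compatible (r ∷ rs) (c ∷ cs) e =
  Compatible-∷ (proj₁ (∷-injective e)) (SameColours⇒Compatible rs cs (proj₂ (∷-injective e)))

Compatible-mapLabelsF : ∀ h cs → ColoursCompatible (mapLabelsF h cs) cs
Compatible-mapLabelsF h cs = SameColours⇒Compatible (mapLabelsF h cs) cs (colours-mapLabelsF h cs)

redCount-mapLabelsF : ∀ h cs → redCount (mapLabelsF h cs) ≡ redCount cs
redCount-mapLabelsF h cs = redCount≡ (Compatible-mapLabelsF h cs)

NotRed-mapLabelsF : ∀ h {cs} → All NotRed cs → All NotRed (mapLabelsF h cs)
NotRed-mapLabelsF h = NotRed⇒ (Compatible-mapLabelsF h _)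

isRed-recolour : ∀ h L {rs cs} → ColoursCompatible rs cs → isRed (node (map h L) rs) ≡ isRed (node L cs)
isRed-recolour h [] compat = allWhite≡ compat
isRed-recolour h (_ ∷ _) _ = refl

Good-recolour : ∀ h L {rs cs} → Good (node L cs) → ColoursCompatible rs cs → IsInterval (node (map h L) rs)
              → Good (node (map h L) rs)
Good-recolour h L {rs} {cs} (good two _ one noRed oneRed) compat interval' = good (two' L two) interval' one' noRed' oneRed'
  where
  two' : ∀ L → (L ≡ [] → 2 ≤ length cs) → map h L ≡ [] → 2 ≤ length rs
  two' [] two _ = ≤-trans (two refl) (length≥ compat)
  two' (_ ∷ _) _ ()
  one' : length (map h L) ≤ 1
  one' rewrite length-map h L = one
  noRed' : map h L ≡ [] ⊎ All NotRed rs
  noRed' = [ (λ e → inj₁ (cong (map h) e)) , (λ a → inj₂ (NotRed⇒ compat a)) ]′ noRed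
  oneRed' : isRed (node (map h L) rs) ≡ false → redCount rs ≤ 1
  oneRed' r = subst (_≤ 1) (sym (redCount≡ compat)) (oneRed (trans (sym (isRed-recolour h L compat)) r))

mutual
  Every-Good-translate : ∀ h p q t → Every Good t → (∀ y → 0 < occ t y → h y + q ≡ y + p) → Every Good (mapLabels h t)
  Every-Good-translate h p q (node L cs) (every g gs) h-transl =
    every (Good-recolour h L g (Compatible-mapLabelsF h cs) (IsInterval-translate h p q (node L cs) (interval g) h-transl))
          (Every-Good-translateF h p q cs gs (λ y py → h-transl y (occ-children L cs py)))

  Every-Good-translateF : ∀ h p q cs → All (Every Good) cs → (∀ y → 0 < occF cs y → h y + q ≡ y + p)
                        → All (Every Good) (mapLabelsF h cs)
  Every-Good-translateF h p q [] [] _ = []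
  Every-Good-translateF h p q (c ∷ cs) (g ∷ gs) h-transl =
    Every-Good-translate h p q c g (λ y py → h-transl y (occF-head c cs py))
    ∷ Every-Good-translateF h p q cs gs (λ y py → h-transl y (occF-tail c cs py))

weight-pos : ∀ t → Every Good t → 1 ≤ weight t
weight-pos (node (_ ∷ _) _) _ = s≤s z≤n
weight-pos (node [] []) (every g _) with twoChildren g refl
... | ()
weight-pos (node [] (c ∷ cs)) (every _ (g ∷ _)) =
  ≤-trans (weight-pos c g) (subst (weight c ≤_) (sym (length-++ (labels c))) (m≤m+n _ _))

some-label : ∀ t → Every Good t → Σ ℕ λ y → 0 < occ t y
some-label t g with labels t | weight-pos t g
... | z ∷ l | _ = z , mult-∷-self z l

labelsF-↭ : ∀ {cs ds} → cs ↭ ds → labelsF cs ↭ labelsF ds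
labelsF-↭ ↭.refl = ↭-refl
labelsF-↭ (prep c p) = ++⁺ˡ (labels c) (labelsF-↭ p)
labelsF-↭ (swap c d p) = ↭-trans (shifts (labels c) (labels d)) (++⁺ˡ (labels d) (++⁺ˡ (labels c) (labelsF-↭ p)))
labelsF-↭ (↭.trans p q) = ↭-trans (labelsF-↭ p) (labelsF-↭ q)

mutual
  ≅⇒labels-↭ : ∀ {T T'} → T ≅ T' → labels T ↭ labels T'
  ≅⇒labels-↭ (node≅ p q) = ↭-++⁺ p (≅F⇒labelsF-↭ q)

  ≅F⇒labelsF-↭ : ∀ {cs cs'} → cs ≅F cs' → labelsF cs ↭ labelsF cs'
  ≅F⇒labelsF-↭ (perm p q) = ↭-trans (labelsF-↭ p) (≅P⇒labelsF-↭ q)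

  ≅P⇒labelsF-↭ : ∀ {cs cs'} → cs ≅P cs' → labelsF cs ↭ labelsF cs'
  ≅P⇒labelsF-↭ [] = ↭-refl
  ≅P⇒labelsF-↭ (i ∷ is) = ↭-++⁺ (≅⇒labels-↭ i) (≅P⇒labelsF-↭ is)

allWhite-↭ : ∀ {cs ds} → cs ↭ ds → allWhite cs ≡ allWhite ds
allWhite-↭ ↭.refl = refl
allWhite-↭ (prep c p) = cong (not (isRed c) ∧_) (allWhite-↭ p)
allWhite-↭ {c ∷ d ∷ cs} (swap c d p) =
  trans (cong (λ w → not (isRed c) ∧ (not (isRed d) ∧ w)) (allWhite-↭ p))
        (x∙yz≈y∙xz (CommutativeMonoid.commutativeSemigroup ∧-commutativeMonoid) (not (isRed c)) (not (isRed d)) _)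
allWhite-↭ (↭.trans p q) = trans (allWhite-↭ p) (allWhite-↭ q)

redCount-↭ : ∀ {cs ds} → cs ↭ ds → redCount cs ≡ redCount ds
redCount-↭ ↭.refl = refl
redCount-↭ (prep c p) rewrite redCount-↭ p = refl
redCount-↭ (swap c d p) rewrite redCount-↭ p with isRed c | isRed d
... | true | true = refl
... | true | false = refl
... | false | true = refl
... | false | false = refl
redCount-↭ (↭.trans p q) = trans (redCount-↭ p) (redCount-↭ q)

mutual
  isRed-≅ : ∀ {T T'} → T ≅ T' → isRed T ≡ isRed T'
  isRed-≅ {node [] _} {node [] _} (node≅ _ q) = allWhite-≅F q
  isRed-≅ {node [] _} {node (_ ∷ _) _} (node≅ p _) with ↭-length p
  ... | ()
  isRed-≅ {node (_ ∷ _) _} {node [] _} (node≅ p _) with ↭-length p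
  ... | ()
  isRed-≅ {node (_ ∷ _) _} {node (_ ∷ _) _} _ = refl

  allWhite-≅F : ∀ {cs cs'} → cs ≅F cs' → allWhite cs ≡ allWhite cs'
  allWhite-≅F (perm p q) = trans (allWhite-↭ p) (allWhite-≅P q)

  allWhite-≅P : ∀ {cs cs'} → cs ≅P cs' → allWhite cs ≡ allWhite cs'
  allWhite-≅P [] = refl
  allWhite-≅P (i ∷ is) = cong₂ (λ a b → not a ∧ b) (isRed-≅ i) (allWhite-≅P is)

redCount-≅P : ∀ {cs cs'} → cs ≅P cs' → redCount cs ≡ redCount cs'
redCount-≅P [] = refl
redCount-≅P (i ∷ is) rewrite isRed-≅ i | redCount-≅P is = refl

length-≅P : ∀ {cs cs'} → cs ≅P cs' → length cs ≡ length cs'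
length-≅P [] = refl
length-≅P (_ ∷ is) = cong suc (length-≅P is)

NotRed-≅P : ∀ {cs cs'} → cs ≅P cs' → All NotRed cs → All NotRed cs'
NotRed-≅P [] [] = []
NotRed-≅P (i ∷ is) (a ∷ as) = trans (sym (isRed-≅ i)) a ∷ NotRed-≅P is as

Good-≅ : ∀ {T T'} → T ≅ T' → Good T → Good T'
Good-≅ {node L cs} {node L' cs'} i@(node≅ p (perm p' q)) (good two (a , m , I) one noRed oneRed) =
  good two' (a , m , λ y → trans (sym (↭⇒mult (≅⇒labels-↭ i) y)) (I y)) one' noRed' oneRed'
  where
  two' : L' ≡ [] → 2 ≤ length cs'
  two' refl rewrite ↭-empty-inv p = subst (2 ≤_) (trans (↭-length p') (length-≅P q)) (two refl)
  one' : length L' ≤ 1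
  one' = subst (_≤ 1) (↭-length p) one
  noRed' : L' ≡ [] ⊎ All NotRed cs'
  noRed' = [ (λ e → inj₁ (↭-empty-inv (↭-sym (subst (_↭ L') e p)))) , (λ a → inj₂ (NotRed-≅P q (All-resp-↭ p' a))) ]′ noRed
  oneRed' : isRed (node L' cs') ≡ false → redCount cs' ≤ 1
  oneRed' r = subst (_≤ 1) (trans (redCount-↭ p') (redCount-≅P q)) (oneRed (trans (isRed-≅ i) r))

mutual
  Every-Good-≅ : ∀ {T T'} → T ≅ T' → Every Good T → Every Good T'
  Every-Good-≅ i@(node≅ _ q) (every g gs) = every (Good-≅ i g) (Every-Good-≅F q gs)

  Every-Good-≅F : ∀ {cs cs'} → cs ≅F cs' → All (Every Good) cs → All (Every Good) cs'
  Every-Good-≅F (perm p q) gs = Every-Good-≅P q (All-resp-↭ p gs)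

  Every-Good-≅P : ∀ {cs cs'} → cs ≅P cs' → All (Every Good) cs → All (Every Good) cs'
  Every-Good-≅P [] [] = []
  Every-Good-≅P (i ∷ is) (g ∷ gs) = Every-Good-≅ i g ∷ Every-Good-≅P is gs

m+n≡1-cases : ∀ m n → m + n ≡ 1 → (m ≡ 1 × n ≡ 0) ⊎ (m ≡ 0 × n ≡ 1)
m+n≡1-cases zero n e = inj₂ (refl , e)
m+n≡1-cases (suc zero) zero _ = inj₁ (refl , refl)

occ-node-≡0 : ∀ L cs {x} → occ (node L cs) x ≡ 0 → mult x L ≡ 0 × occF cs x ≡ 0
occ-node-≡0 L cs {x} e = let e' = trans (sym (occ-node L cs x)) e in m+n≡0⇒m≡0 _ e' , m+n≡0⇒n≡0 _ e'

occF-∷-≡0 : ∀ c cs {x} → occF (c ∷ cs) x ≡ 0 → occ c x ≡ 0 × occF cs x ≡ 0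
occF-∷-≡0 c cs {x} e = let e' = trans (sym (occF-∷ c cs x)) e in m+n≡0⇒m≡0 _ e' , m+n≡0⇒n≡0 _ e'

≡ᵇ-refl : ∀ x → (x ≡ᵇ x) ≡ true
≡ᵇ-refl x with x ≡ᵇ x in e
... | true = refl
... | false = ⊥-elim (subst T e (≡⇒≡ᵇ x x refl))

≡ᵇ-≢ : ∀ {v x} → v ≢ x → (v ≡ᵇ x) ≡ false
≡ᵇ-≢ {v} {x} v≢x with v ≡ᵇ x in e
... | true = ⊥-elim (v≢x (≡ᵇ⇒≡ v x (subst T (sym e) tt)))
... | false = refl

memb≡true⇒mult-pos : ∀ x l → memb x l ≡ true → 0 < mult x l
memb≡true⇒mult-pos x (v ∷ l) e with δ-view v x
... | inj₁ (_ , δ≡1) rewrite δ≡1 = s≤s z≤n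
... | inj₂ (v≢x , δ≡0) rewrite δ≡0 = memb≡true⇒mult-pos x l (subst (λ b → b ∨ memb x l ≡ true) (≡ᵇ-≢ v≢x) e)

memb≡false⇒mult≡0 : ∀ x l → memb x l ≡ false → mult x l ≡ 0
memb≡false⇒mult≡0 x [] _ = refl
memb≡false⇒mult≡0 x (v ∷ l) e with δ-view v x
... | inj₁ (refl , _) = case trans (sym (cong (_∨ memb v l) (≡ᵇ-refl v))) e of λ ()
... | inj₂ (v≢x , δ≡0) rewrite δ≡0 = memb≡false⇒mult≡0 x l (subst (λ b → b ∨ memb x l ≡ false) (≡ᵇ-≢ v≢x) e)

mult≡0⇒memb≡false : ∀ x l → mult x l ≡ 0 → memb x l ≡ false
mult≡0⇒memb≡false x l e with memb x l in m
... | true = ⊥-elim (<-irrefl (sym e) (memb≡true⇒mult-pos x l m))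
... | false = refl

memb-self : ∀ x → memb x (x ∷ []) ≡ true
memb-self x = cong (_∨ false) (≡ᵇ-refl x)

remove-self : ∀ x → remove x (x ∷ []) ≡ []
remove-self x rewrite ≡ᵇ-refl x = refl

mutual
  substW-fresh : ∀ {x R D} t → occ t x ≡ 0 → substW x R D t ≡ t
  substW-fresh {x} (node L cs) tx≡0 with occ-node-≡0 L cs tx≡0
  ... | Lx≡0 , csx≡0 rewrite mult≡0⇒memb≡false x L Lx≡0 = cong (node L) (substWF-fresh cs csx≡0)

  substWF-fresh : ∀ {x R D} cs → occF cs x ≡ 0 → substWF x R D cs ≡ cs
  substWF-fresh [] _ = refl
  substWF-fresh (c ∷ cs) e with occF-∷-≡0 c cs e
  ... | cx≡0 , csx≡0 = cong₂ _∷_ (substW-fresh c cx≡0) (substWF-fresh cs csx≡0)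

substW-at-root : ∀ x R D cs → substW x R D (node (x ∷ []) cs) ≡ node R (cs ++ D)
substW-at-root x R D cs rewrite memb-self x | remove-self x = refl

substR-at-root : ∀ x S cs → substR x S (node (x ∷ []) cs) ≡ node [] (cs ++ S ∷ [])
substR-at-root x S cs rewrite memb-self x | remove-self x = refl

tree-η : ∀ t → node (rootLabels t) (children t) ≡ t
tree-η (node _ _) = refl

substWF-++ : ∀ {x R D} cs ds → substWF x R D (cs ++ ds) ≡ substWF x R D cs ++ substWF x R D ds
substWF-++ [] ds = refl
substWF-++ (c ∷ cs) ds = cong (_ ∷_) (substWF-++ cs ds)

substW-at-child : ∀ x R D L pre post → mult x L ≡ 0 → occF pre x ≡ 0 → occF post x ≡ 0
                → substW x R D (node L (pre ++ leaf x ∷ post)) ≡ node L (pre ++ node R D ∷ post)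
substW-at-child x R D L pre post Lx≡0 prex≡0 postx≡0 rewrite mult≡0⇒memb≡false x L Lx≡0 =
  cong (node L) (trans (substWF-++ pre (leaf x ∷ post))
                       (cong₂ _++_ (substWF-fresh pre prex≡0) (cong₂ _∷_ leaf-x (substWF-fresh post postx≡0))))
  where
  leaf-x : substW x R D (leaf x) ≡ node R D
  leaf-x rewrite memb-self x | remove-self x = refl

sole-leaf : ∀ {x} t → isSoleLeaf x t ≡ true → t ≡ leaf x
sole-leaf (node (y ∷ []) []) e = cong leaf (≡ᵇ⇒≡ y _ (subst T (sym e) tt))

occ-sole-leaf : ∀ {x} t → isSoleLeaf x t ≡ true → occ t x ≡ 1
occ-sole-leaf {x} t e rewrite sole-leaf t e = trans (occ-leaf x x) (δ-refl x)

mutual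
  substR-fresh : ∀ {x S} t → occ t x ≡ 0 → substR x S t ≡ t
  substR-fresh {x} (node L cs) tx≡0 with occ-node-≡0 L cs tx≡0
  ... | Lx≡0 , csx≡0 rewrite mult≡0⇒memb≡false x L Lx≡0 = cong (node L) (substRF-fresh cs csx≡0)

  substRF-fresh : ∀ {x S} cs → occF cs x ≡ 0 → substRF x S cs ≡ cs
  substRF-fresh [] _ = refl
  substRF-fresh {x} (c ∷ cs) e with occF-∷-≡0 c cs e | isSoleLeaf x c in sole
  ... | cx≡0 , _ | true = case trans (sym cx≡0) (occ-sole-leaf c sole) of λ ()
  ... | cx≡0 , csx≡0 | false = cong₂ _∷_ (substR-fresh c cx≡0) (substRF-fresh cs csx≡0)

-- Making room for k + 1 labels at position x

-- the relabelling of T₁ in T₁ ∘ₓ T₂ when T₂ has weight k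
bump : ℕ → ℕ → ℕ → ℕ
bump x k y = if x <ᵇ y then y + k ∸ 1 else y

bump-≤ : ∀ {x k y} → y ≤ x → bump x k y ≡ y
bump-≤ {x} {k} {y} y≤x with x <ᵇ y in e
... | true = ⊥-elim (<⇒≱ (<ᵇ⇒< x y (subst T (sym e) tt)) y≤x)
... | false = refl

bump-> : ∀ {x k y} → x < y → bump x (suc k) y ≡ y + k
bump-> {x} {k} {y} x<y with x <ᵇ y in e
... | true = cong (_∸ 1) (+-suc y k)
... | false = ⊥-elim (subst T e (<⇒<ᵇ x<y))

module Bump (x k : ℕ) where

  up : ℕ → ℕ
  up = bump x (suc k)

  up-injective : ∀ u v → up u ≡ up v → u ≡ v
  up-injective u v e with u ≤? x | v ≤? x
  ... | yes u≤x | yes v≤x = trans (sym (bump-≤ u≤x)) (trans e (bump-≤ v≤x))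
  ... | no u≰x | no v≰x = +-cancelʳ-≡ k u v (trans (sym (bump-> (≰⇒> u≰x))) (trans e (bump-> (≰⇒> v≰x))))
  ... | yes u≤x | no v≰x = ⊥-elim (<⇒≱ (<-≤-trans (≤-<-trans u≤x (≰⇒> v≰x)) (m≤m+n v k))
                                        (≤-reflexive (trans (sym (bump-> (≰⇒> v≰x))) (trans (sym e) (bump-≤ u≤x)))))
  ... | no u≰x | yes v≤x = ⊥-elim (<⇒≱ (<-≤-trans (≤-<-trans v≤x (≰⇒> u≰x)) (m≤m+n u k))
                                        (≤-reflexive (trans (sym (bump-> (≰⇒> u≰x))) (trans e (bump-≤ v≤x)))))

  up≡x⇒ : ∀ u → up u ≡ x → u ≡ x
  up≡x⇒ u e = up-injective u x (trans e (sym (bump-≤ ≤-refl)))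

  up-misses-gap : ∀ {y} → x < y → y ≤ x + k → ∀ v → up v ≢ y
  up-misses-gap {y} x<y y≤x+k v e with v ≤? x
  ... | yes v≤x = <⇒≱ x<y (subst (_≤ x) (trans (sym (bump-≤ v≤x)) e) v≤x)
  ... | no v≰x = <⇒≱ (≰⇒> v≰x) (+-cancelʳ-≤ k v x (subst (_≤ x + k) (trans (sym e) (bump-> (≰⇒> v≰x))) y≤x+k))

  above-gap : ∀ {y} → x + k < y → x < y ∸ k × y ∸ k + k ≡ y
  above-gap {y} x+k<y = m+n≤o⇒m≤o∸n (suc x) x+k<y , m∸n+n≡m (≤-trans (m≤n+m k x) (<⇒≤ x+k<y))

  mult-up-≤ : ∀ l {y} → y ≤ x → mult y (map up l) ≡ mult y l
  mult-up-≤ l y≤x = mult-map-hit up l (bump-≤ y≤x) (λ v _ e → up-injective v _ (trans e (sym (bump-≤ y≤x))))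

  occ-up-≤ : ∀ t {y} → y ≤ x → occ (mapLabels up t) y ≡ occ t y
  occ-up-≤ t y≤x rewrite labels-mapLabels up t = mult-up-≤ (labels t) y≤x

  occF-up-≤ : ∀ cs {y} → y ≤ x → occF (mapLabelsF up cs) y ≡ occF cs y
  occF-up-≤ cs y≤x rewrite labelsF-mapLabelsF up cs = mult-up-≤ (labelsF cs) y≤x

  occ-up-gap : ∀ t {y} → x < y → y ≤ x + k → occ (mapLabels up t) y ≡ 0
  occ-up-gap t x<y y≤x+k = occ-mapLabels-miss up t (λ v _ → up-misses-gap x<y y≤x+k v)

  occ-up-> : ∀ t {y} → x + k < y → occ (mapLabels up t) y ≡ occ t (y ∸ k)
  occ-up-> t {y} x+k<y = occ-mapLabels-hit up t up[y-k] (λ v _ e → up-injective v (y ∸ k) (trans e (sym up[y-k])))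
    where
    up[y-k] : up (y ∸ k) ≡ y
    up[y-k] = trans (bump-> (proj₁ (above-gap x+k<y))) (proj₂ (above-gap x+k<y))

  -- r is t with its label x replaced by a tree spanning [x, x + k], the other labels being bumped
  Inserted : Tree → Tree → Set
  Inserted t r = ∀ y → occ r y + δ x y ≡ occ (mapLabels up t) y + χ x (suc k) y

  module Insertion (t r : Tree) {a m : ℕ} (I : Spans t a m) (tx≡1 : occ t x ≡ 1) (E : Inserted t r) where
    open ≡-Reasoning

    x-inside : a ≤ x × x < a + m
    x-inside = χ-pos⇒inside (subst (0 <_) (trans (sym tx≡1) (I x)) (s≤s z≤n))

    a+m≤a+[m+k] : a + m ≤ a + (m + k)
    a+m≤a+[m+k] = +-monoʳ-≤ a (m≤m+n m k)

    occ-below : ∀ {y} → y < x → occ r y ≡ χ a (m + k) y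
    occ-below {y} y<x = begin
      occ r y                                ≡⟨ sym (+-identityʳ _) ⟩
      occ r y + 0                            ≡⟨ cong (occ r y +_) (sym (δ-≢ (>⇒≢ y<x))) ⟩
      occ r y + δ x y                        ≡⟨ E y ⟩
      occ (mapLabels up t) y + χ x (suc k) y ≡⟨ cong₂ _+_ (occ-up-≤ t (<⇒≤ y<x)) (χ-below y<x) ⟩
      occ t y + 0                            ≡⟨ trans (+-identityʳ _) (I y) ⟩
      χ a m y                                ≡⟨ χ-resize y<a+m (≤-trans y<a+m a+m≤a+[m+k]) ⟩
      χ a (m + k) y                          ∎
      where
      y<a+m : y < a + m
      y<a+m = <-trans y<x (proj₂ x-inside)

    occ-at : occ r x ≡ χ a (m + k) x
    occ-at = +-cancelʳ-≡ 1 (occ r x) (χ a (m + k) x) (begin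
      occ r x + 1                            ≡⟨ cong (occ r x +_) (sym (δ-refl x)) ⟩
      occ r x + δ x x                        ≡⟨ E x ⟩
      occ (mapLabels up t) x + χ x (suc k) x ≡⟨ cong₂ _+_ (trans (occ-up-≤ t ≤-refl) tx≡1) (χ-inside ≤-refl (m<m+n x (s≤s z≤n))) ⟩
      1 + 1                                  ≡⟨ cong (_+ 1) (sym (χ-inside (proj₁ x-inside) (≤-trans (proj₂ x-inside) a+m≤a+[m+k]))) ⟩
      χ a (m + k) x + 1                      ∎)

    occ-gap : ∀ {y} → x < y → y ≤ x + k → occ r y ≡ χ a (m + k) y
    occ-gap {y} x<y y≤x+k = +-cancelʳ-≡ 0 (occ r y) (χ a (m + k) y) (begin
      occ r y + 0                            ≡⟨ cong (occ r y +_) (sym (δ-≢ (<⇒≢ x<y))) ⟩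
      occ r y + δ x y                        ≡⟨ E y ⟩
      occ (mapLabels up t) y + χ x (suc k) y ≡⟨ cong₂ _+_ (occ-up-gap t x<y y≤x+k) (χ-inside (<⇒≤ x<y) (subst (y <_) (sym (+-suc x k)) (s≤s y≤x+k))) ⟩
      1                                      ≡⟨ sym (χ-inside (≤-trans (proj₁ x-inside) (<⇒≤ x<y)) y<a+m+k) ⟩
      χ a (m + k) y                          ≡⟨ sym (+-identityʳ _) ⟩
      χ a (m + k) y + 0                      ∎)
      where
      y<a+m+k : y < a + (m + k)
      y<a+m+k = ≤-<-trans y≤x+k (subst (x + k <_) (+-assoc a m k) (+-monoˡ-< k (proj₂ x-inside)))

    occ-above : ∀ {y} → x + k < y → occ r y ≡ χ a (m + k) y
    occ-above {y} x+k<y = +-cancelʳ-≡ 0 (occ r y) (χ a (m + k) y) (begin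
      occ r y + 0                            ≡⟨ cong (occ r y +_) (sym (δ-≢ (<⇒≢ (≤-<-trans (m≤m+n x k) x+k<y)))) ⟩
      occ r y + δ x y                        ≡⟨ E y ⟩
      occ (mapLabels up t) y + χ x (suc k) y ≡⟨ cong₂ _+_ (occ-up-> t x+k<y) (χ-above (subst (_≤ y) (sym (+-suc x k)) x+k<y)) ⟩
      occ t (y ∸ k) + 0                      ≡⟨ trans (+-identityʳ _) (I (y ∸ k)) ⟩
      χ a m (y ∸ k)                          ≡⟨ χ-stretch (≤-trans (proj₁ x-inside) (<⇒≤ (proj₁ (above-gap x+k<y)))) ⟩
      χ a (m + k) (y ∸ k + k)                ≡⟨ cong (χ a (m + k)) (proj₂ (above-gap x+k<y)) ⟩
      χ a (m + k) y                          ≡⟨ sym (+-identityʳ _) ⟩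
      χ a (m + k) y + 0                      ∎)

    spans : Spans r a (m + k)
    spans y with <-cmp y x
    ... | tri< y<x _ _ = occ-below y<x
    ... | tri≈ _ refl _ = occ-at
    ... | tri> _ _ x<y with y ≤? x + k
    ...   | yes y≤x+k = occ-gap x<y y≤x+k
    ...   | no y≰x+k = occ-above (≰⇒> y≰x+k)

  Spans-insert : ∀ t r {a m} → Spans t a m → occ t x ≡ 1 → Inserted t r → Spans r a (m + k)
  Spans-insert t r I tx≡1 E = Insertion.spans t r I tx≡1 E

  Every-Good-up : ∀ t → Every Good t → occ t x ≡ 0 → Every Good (mapLabels up t)
  Every-Good-up t g tx≡0 with interval (Every-root g)
  ... | a , m , I with χ-view a m x
  ... | inj₁ (_ , _ , χ≡1) = case trans (sym tx≡0) (trans (I x) χ≡1) of λ ()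
  ... | inj₂ (inj₁ x<a , _) = Every-Good-translate up k 0 t g above
    where
    above : ∀ y → 0 < occ t y → up y + 0 ≡ y + k
    above y py = trans (+-identityʳ _) (bump-> (<-≤-trans x<a (proj₁ (χ-pos⇒inside (subst (0 <_) (I y) py)))))
  ... | inj₂ (inj₂ a+m≤x , _) = Every-Good-translate up 0 0 t g below
    where
    below : ∀ y → 0 < occ t y → up y + 0 ≡ y + 0
    below y py = cong (_+ 0) (bump-≤ (<⇒≤ (<-≤-trans (proj₂ (χ-pos⇒inside (subst (0 <_) (I y) py))) a+m≤x)))

  Every-Good-upF : ∀ cs → All (Every Good) cs → occF cs x ≡ 0 → All (Every Good) (mapLabelsF up cs)
  Every-Good-upF [] [] _ = []
  Every-Good-upF (c ∷ cs) (g ∷ gs) e with occF-∷-≡0 c cs e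
  ... | cx≡0 , csx≡0 = Every-Good-up c g cx≡0 ∷ Every-Good-upF cs gs csx≡0

  isSoleLeaf-up : ∀ t → isSoleLeaf x t ≡ false → isSoleLeaf x (mapLabels up t) ≡ false
  isSoleLeaf-up (node [] _) _ = refl
  isSoleLeaf-up (node (_ ∷ _ ∷ _) _) _ = refl
  isSoleLeaf-up (node (_ ∷ []) (_ ∷ _)) _ = refl
  isSoleLeaf-up (node (u ∷ []) []) u≢x with up u ≡ᵇ x in e
  ... | false = refl
  ... | true = case trans (sym u≢x) (trans (cong (_≡ᵇ x) (up≡x⇒ u (≡ᵇ⇒≡ (up u) x (subst T (sym e) tt)))) (≡ᵇ-refl x)) of λ ()

  InsertedF : List Tree → List Tree → Set
  InsertedF cs rs = ∀ y → occF rs y + δ x y ≡ occF (mapLabelsF up cs) y + χ x (suc k) y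

  Inserted-node : ∀ L {cs rs} → InsertedF cs rs → Inserted (node L cs) (node (map up L) rs)
  Inserted-node L {cs} {rs} E y rewrite occ-node (map up L) rs y | occ-node (map up L) (mapLabelsF up cs) y =
    trans (+-assoc (mult y (map up L)) _ _) (trans (cong (mult y (map up L) +_) (E y)) (sym (+-assoc (mult y (map up L)) _ _)))

  InsertedF-head : ∀ {c r} cs → Inserted c r → InsertedF (c ∷ cs) (r ∷ mapLabelsF up cs)
  InsertedF-head {c} {r} cs E y rewrite occF-∷ r (mapLabelsF up cs) y | occF-∷ (mapLabels up c) (mapLabelsF up cs) y = begin
    occ r y + occF cs' y + δ x y                      ≡⟨ xy∙z≈xz∙y +-commutativeSemigroup (occ r y) _ _ ⟩
    occ r y + δ x y + occF cs' y                      ≡⟨ cong (_+ occF cs' y) (E y) ⟩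
    occ (mapLabels up c) y + χ x (suc k) y + occF cs' y ≡⟨ xy∙z≈xz∙y +-commutativeSemigroup (occ (mapLabels up c) y) _ _ ⟩
    occ (mapLabels up c) y + occF cs' y + χ x (suc k) y ∎
    where
    open ≡-Reasoning
    cs' : List Tree
    cs' = mapLabelsF up cs

  InsertedF-tail : ∀ c {cs rs} → InsertedF cs rs → InsertedF (c ∷ cs) (mapLabels up c ∷ rs)
  InsertedF-tail c {cs} {rs} E y rewrite occF-∷ (mapLabels up c) rs y | occF-∷ (mapLabels up c) (mapLabelsF up cs) y =
    trans (+-assoc (occ (mapLabels up c) y) _ _) (trans (cong (occ (mapLabels up c) y +_) (E y)) (sym (+-assoc (occ (mapLabels up c) y) _ _)))

  interval-of-insertion : ∀ t r → Good t → occ t x ≡ 1 → Inserted t r → IsInterval r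
  interval-of-insertion t r g tx≡1 E with interval g
  ... | a , m , I = a , m + k , Spans-insert t r I tx≡1 E

  record Substitution (t r : Tree) : Set where
    field
      everyGood : Every Good r
      colour    : isRed r ≡ isRed t
      inserted  : Inserted t r

  record SubstitutionF (cs rs : List Tree) : Set where
    field
      everyGoodF : All (Every Good) rs
      colours    : ColoursCompatible rs cs
      insertedF  : InsertedF cs rs

  open Substitution public
  open SubstitutionF public

  Substitution-node : ∀ L {cs rs} → Good (node L cs) → occ (node L cs) x ≡ 1 → SubstitutionF cs rs
                    → Substitution (node L cs) (node (map up L) rs)
  Substitution-node L {cs} {rs} g tx≡1 σ = record
    { everyGood = every (Good-recolour up L g (colours σ) interval') (everyGoodF σ)
    ; colour = isRed-recolour up L (colours σ)
    ; inserted = E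
    }
    where
    E : Inserted (node L cs) (node (map up L) rs)
    E = Inserted-node L {cs} {rs} (insertedF σ)
    interval' : IsInterval (node (map up L) rs)
    interval' = interval-of-insertion (node L cs) (node (map up L) rs) g tx≡1 E

  SubstitutionF-head : ∀ {c r} cs → All (Every Good) cs → occF cs x ≡ 0 → Substitution c r
                     → SubstitutionF (c ∷ cs) (r ∷ mapLabelsF up cs)
  SubstitutionF-head {c} {r} cs gs csx≡0 σ = record
    { everyGoodF = everyGood σ ∷ Every-Good-upF cs gs csx≡0
    ; colours = Compatible-∷ (colour σ) (Compatible-mapLabelsF up cs)
    ; insertedF = InsertedF-head {c} {r} cs (inserted σ)
    }

  SubstitutionF-tail : ∀ c {cs rs} → Every Good c → occ c x ≡ 0 → SubstitutionF cs rs
                     → SubstitutionF (c ∷ cs) (mapLabels up c ∷ rs)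
  SubstitutionF-tail c {cs} {rs} g cx≡0 σ = record
    { everyGoodF = Every-Good-up c g cx≡0 ∷ everyGoodF σ
    ; colours = Compatible-∷ (isRed-mapLabels up c) (colours σ)
    ; insertedF = InsertedF-tail c {cs} {rs} (insertedF σ)
    }

  label-is-x : ∀ {L cs} → Good (node L cs) → memb x (map up L) ≡ true → L ≡ x ∷ []
  label-is-x {[]} _ ()
  label-is-x {u ∷ []} _ e with memb≡true⇒mult-pos x (up u ∷ []) e | δ-view (up u) x
  ... | _ | inj₁ (up-u≡x , _) = cong (_∷ []) (up≡x⇒ u up-u≡x)
  ... | pos | inj₂ (_ , δ≡0) rewrite δ≡0 = case pos of λ ()
  label-is-x {_ ∷ _ ∷ _} g _ with atMostOneLabel g
  ... | s≤s ()

  remove-up-x : remove x (up x ∷ []) ≡ []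
  remove-up-x = trans (cong (λ w → remove x (w ∷ [])) (bump-≤ {x} {suc k} ≤-refl)) (remove-self x)

  occF-children-≡0 : ∀ cs → occ (node (x ∷ []) cs) x ≡ 1 → occF cs x ≡ 0
  occF-children-≡0 cs tx≡1 = +-cancelˡ-≡ 1 _ 0 (begin
    1 + occF cs x                ≡⟨ cong (_+ occF cs x) (sym (trans (+-identityʳ _) (δ-refl x))) ⟩
    mult x (x ∷ []) + occF cs x  ≡⟨ sym (occ-node (x ∷ []) cs x) ⟩
    occ (node (x ∷ []) cs) x     ≡⟨ tx≡1 ⟩
    1                            ∎)
    where open ≡-Reasoning

  occF-children-≡1 : ∀ L cs → memb x (map up L) ≡ false → occ (node L cs) x ≡ 1 → occF cs x ≡ 1
  occF-children-≡1 L cs e tx≡1 = trans (sym (cong (_+ occF cs x) Lx≡0)) (trans (sym (occ-node L cs x)) tx≡1)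
    where
    Lx≡0 : mult x L ≡ 0
    Lx≡0 = trans (sym (mult-up-≤ L ≤-refl)) (memb≡false⇒mult≡0 x (map up L) e)

-- Case (W): the root of S = node R D, spanning [x, x + k], is merged into the node labelled x.
module SubstitutionW (x k : ℕ) (R : List ℕ) (D : List Tree)
  (S-good : Every Good (node R D)) (S-white : isRed (node R D) ≡ false) (S-spans : Spans (node R D) x (suc k)) where
  open Bump x k public

  substW-root : ∀ cs → All (Every Good) cs → Good (node (x ∷ []) cs) → occ (node (x ∷ []) cs) x ≡ 1
              → Substitution (node (x ∷ []) cs) (node R (mapLabelsF up cs ++ D))
  substW-root cs gs g tx≡1 = record
    { everyGood = every g' (++⁺ (Every-Good-upF cs gs (occF-children-≡0 cs tx≡1)) (Every-children S-good))
    ; colour = isRed-++ʳ R cs' S-white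
    ; inserted = E
    }
    where
    cs' = mapLabelsF up cs
    gS : Good (node R D)
    gS = Every-root S-good
    E : Inserted (node (x ∷ []) cs) (node R (cs' ++ D))
    E y rewrite occ-node R (cs' ++ D) y | occF-++ y cs' D | occ-node (up x ∷ []) cs' y | bump-≤ {x} {suc k} (≤-refl {x})
              | +-identityʳ (δ x y) | sym (S-spans y) | occ-node R D y
      = solve 4 (λ r a b d → r :+ (a :+ b) :+ d := d :+ a :+ (r :+ b)) refl (mult y R) (occF cs' y) (occF D y) (δ x y)
    cs-white : All NotRed cs
    cs-white = [ (λ ()) , (λ a → a) ]′ (noRedChild g)
    g' : Good (node R (cs' ++ D))
    g' = good (λ R≡[] → ≤-trans (twoChildren gS R≡[]) (subst (length D ≤_) (sym (length-++ cs')) (m≤n+m _ _)))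
              (interval-of-insertion (node (x ∷ []) cs) (node R (cs' ++ D)) g tx≡1 E)
              (atMostOneLabel gS)
              ([ inj₁ , (λ D-white → inj₂ (++⁺ (NotRed-mapLabelsF up cs-white) D-white)) ]′ (noRedChild gS))
              (λ _ → subst (_≤ 1) (sym (trans (redCount-++ cs' D) (cong (_+ redCount D) (trans (redCount-mapLabelsF up cs) (NotRed⇒redCount≡0 cs-white))))) (atMostOneRed gS S-white))

  mutual
    substW-up : ∀ t → Every Good t → occ t x ≡ 1 → Substitution t (substW x R D (mapLabels up t))
    substW-up (node L cs) (every g gs) tx≡1 with memb x (map up L) in e
    ... | false = Substitution-node L g tx≡1 (substW-upF cs gs (occF-children-≡1 L cs e tx≡1))
    ... | true with label-is-x g e
    ...   | refl = subst (λ l → Substitution (node (x ∷ []) cs) (node (l ++ R) (mapLabelsF up cs ++ D))) (sym remove-up-x)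
                     (substW-root cs gs g tx≡1)

    substW-upF : ∀ cs → All (Every Good) cs → occF cs x ≡ 1 → SubstitutionF cs (substWF x R D (mapLabelsF up cs))
    substW-upF (c ∷ cs) (g ∷ gs) e with m+n≡1-cases (occ c x) (occF cs x) (trans (sym (occF-∷ c cs x)) e)
    ... | inj₁ (cx≡1 , csx≡0) =
      subst (λ rs → SubstitutionF (c ∷ cs) (_ ∷ rs)) (sym (substWF-fresh (mapLabelsF up cs) (trans (occF-up-≤ cs ≤-refl) csx≡0)))
            (SubstitutionF-head cs gs csx≡0 (substW-up c g cx≡1))
    ... | inj₂ (cx≡0 , csx≡1) =
      subst (λ r → SubstitutionF (c ∷ cs) (r ∷ _)) (sym (substW-fresh (mapLabels up c) (trans (occ-up-≤ c ≤-refl) cx≡0)))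
            (SubstitutionF-tail c g cx≡0 (substW-upF cs gs csx≡1))

module SubstitutionR (x k : ℕ) (DS : List Tree)
  (S-good : Every Good (node [] DS)) (S-red : allWhite DS ≡ true) (S-spans : Spans (node [] DS) x (suc k)) where
  open Bump x k public

  S : Tree
  S = node [] DS

  DS-white : All NotRed DS
  DS-white = allWhite⇒NotRed DS S-red

  substR-root : ∀ cs → All (Every Good) cs → Good (node (x ∷ []) cs) → occ (node (x ∷ []) cs) x ≡ 1
              → isSoleLeaf x (node (up x ∷ []) (mapLabelsF up cs)) ≡ false
              → Substitution (node (x ∷ []) cs) (node [] (mapLabelsF up cs ++ S ∷ []))
  substR-root [] _ _ _ not-sole = case trans (sym not-sole) (trans (cong (_≡ᵇ x) (bump-≤ {x} {suc k} ≤-refl)) (≡ᵇ-refl x)) of λ ()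
  substR-root (c ∷ cs) gs g tx≡1 _ = record
    { everyGood = every g' (++⁺ (Every-Good-upF (c ∷ cs) gs (occF-children-≡0 (c ∷ cs) tx≡1)) (S-good ∷ []))
    ; colour = isRed-++ʳ [] cs' S-alone-white
    ; inserted = E
    }
    where
    cs' : List Tree
    cs' = mapLabelsF up (c ∷ cs)
    S-alone-white : isRed (node [] (S ∷ [])) ≡ false
    S-alone-white rewrite S-red = refl
    E : Inserted (node (x ∷ []) (c ∷ cs)) (node [] (cs' ++ S ∷ []))
    E y rewrite occF-++ y cs' (S ∷ []) | occ-node (up x ∷ []) cs' y | bump-≤ {x} {suc k} (≤-refl {x}) | +-identityʳ (δ x y)
              | occF-∷ S [] y | +-identityʳ (occ S y) | S-spans y
      = solve 3 (λ a b d → a :+ b :+ d := d :+ a :+ b) refl (occF cs' y) (χ x (suc k) y) (δ x y)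
    cs-white : All NotRed (c ∷ cs)
    cs-white = [ (λ ()) , (λ a → a) ]′ (noRedChild g)
    one-red : redCount (cs' ++ S ∷ []) ≡ 1
    one-red rewrite redCount-++ cs' (S ∷ []) | redCount-mapLabelsF up (c ∷ cs) | NotRed⇒redCount≡0 cs-white | S-red = refl
    g' : Good (node [] (cs' ++ S ∷ []))
    g' = good (λ _ → subst (2 ≤_) (sym (length-++ cs')) (+-monoˡ-≤ 1 (s≤s z≤n)))
              (interval-of-insertion (node (x ∷ []) (c ∷ cs)) (node [] (cs' ++ S ∷ [])) g tx≡1 E)
              z≤n (inj₁ refl) (λ _ → ≤-reflexive one-red)

  substR-sole : ∀ c cs → All (Every Good) cs → mapLabels up c ≡ leaf x → occF cs x ≡ 0
              → SubstitutionF (c ∷ cs) (DS ++ mapLabelsF up cs)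
  substR-sole c cs gs c↦x csx≡0 = record
    { everyGoodF = ++⁺ (Every-children S-good) (Every-Good-upF cs gs csx≡0)
    ; colours = record
      { allWhite≡ = trans (allWhite-++ DS cs') (trans (cong (_∧ allWhite cs') S-red) (cong₂ (λ a b → not a ∧ b) (sym c-white) (allWhite-mapLabelsF up cs)))
      ; redCount≡ = trans (redCount-++ DS cs') (trans (cong (_+ redCount cs') (NotRed⇒redCount≡0 DS-white)) redCount-tail)
      ; NotRed⇒ = λ { (_ ∷ ps) → ++⁺ DS-white (NotRed-mapLabelsF up ps) }
      ; length≥ = subst (suc (length cs) ≤_) (sym (trans (length-++ DS) (cong (length DS +_) (length-mapLabelsF up cs))))
                        (+-monoˡ-≤ (length cs) (≤-trans (s≤s z≤n) (twoChildren (Every-root S-good) refl)))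
      }
    ; insertedF = E
    }
    where
    cs' = mapLabelsF up cs
    c-white : isRed c ≡ false
    c-white = trans (sym (isRed-mapLabels up c)) (cong isRed c↦x)
    redCount-tail : redCount cs' ≡ redCount (c ∷ cs)
    redCount-tail rewrite c-white = redCount-mapLabelsF up cs
    E : InsertedF (c ∷ cs) (DS ++ cs')
    E y rewrite occF-++ y DS cs' | occF-∷ (mapLabels up c) cs' y | c↦x | occ-leaf x y | sym (S-spans y) | occ-node [] DS y
      = solve 3 (λ a b d → a :+ b :+ d := d :+ b :+ a) refl (occF DS y) (occF cs' y) (δ x y)

  mutual
    substR-up : ∀ t → Every Good t → occ t x ≡ 1 → isSoleLeaf x (mapLabels up t) ≡ false
              → Substitution t (substR x S (mapLabels up t))
    substR-up (node L cs) (every g gs) tx≡1 not-sole with memb x (map up L) in e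
    ... | false = Substitution-node L g tx≡1 (substR-upF cs gs (occF-children-≡1 L cs e tx≡1))
    ... | true with label-is-x g e
    ...   | refl = subst (λ l → Substitution (node (x ∷ []) cs) (node l (mapLabelsF up cs ++ S ∷ []))) (sym remove-up-x)
                         (substR-root cs gs g tx≡1 not-sole)

    substR-upF : ∀ cs → All (Every Good) cs → occF cs x ≡ 1 → SubstitutionF cs (substRF x S (mapLabelsF up cs))
    substR-upF (c ∷ cs) (g ∷ gs) e with m+n≡1-cases (occ c x) (occF cs x) (trans (sym (occF-∷ c cs x)) e) | isSoleLeaf x (mapLabels up c) in sole
    ... | inj₂ (cx≡0 , csx≡1) | true = case trans (sym cx≡0) (trans (sym (occ-up-≤ c ≤-refl)) (occ-sole-leaf (mapLabels up c) sole)) of λ ()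
    ... | inj₁ (cx≡1 , csx≡0) | true =
      subst (λ rs → SubstitutionF (c ∷ cs) (DS ++ rs)) (sym (substRF-fresh (mapLabelsF up cs) (trans (occF-up-≤ cs ≤-refl) csx≡0)))
            (substR-sole c cs gs (sole-leaf (mapLabels up c) sole) csx≡0)
    ... | inj₁ (cx≡1 , csx≡0) | false =
      subst (λ rs → SubstitutionF (c ∷ cs) (_ ∷ rs)) (sym (substRF-fresh (mapLabelsF up cs) (trans (occF-up-≤ cs ≤-refl) csx≡0)))
            (SubstitutionF-head cs gs csx≡0 (substR-up c g cx≡1 sole))
    ... | inj₂ (cx≡0 , csx≡1) | false =
      subst (λ r → SubstitutionF (c ∷ cs) (r ∷ _)) (sym (substR-fresh (mapLabels up c) (trans (occ-up-≤ c ≤-refl) cx≡0)))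
            (SubstitutionF-tail c g cx≡0 (substR-upF cs gs csx≡1))

-- Soundness of composition

-- T₂ with its labels raised by x - 1, as it sits inside T₁ ∘ₓ T₂
raise : ℕ → Tree → Tree
raise x B = mapLabels (λ y → y + (x ∸ 1)) B

compose-cases : Tree → ℕ → Tree → Bool → Bool → Tree
compose-cases A x B red sole =
  if red then (if sole then raise x B else substR x (raise x B) (mapLabels (bump x (weight B)) A))
  else substW x (rootLabels (raise x B)) (children (raise x B)) (mapLabels (bump x (weight B)) A)

compose-white : ∀ A x B → isRed B ≡ false
              → compose A x B ≡ substW x (rootLabels (raise x B)) (children (raise x B)) (mapLabels (bump x (weight B)) A)
compose-white A x B B-white = cong (λ red → compose-cases A x B red (isSoleLeaf x A)) B-white

compose-red : ∀ A x B → isRed B ≡ true → isSoleLeaf x A ≡ false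
            → compose A x B ≡ substR x (raise x B) (mapLabels (bump x (weight B)) A)
compose-red A x B = cong₂ (compose-cases A x B)

Spans-raise : ∀ B x {k} → 1 ≤ x → Spans B 1 k → Spans (raise x B) x k
Spans-raise B x 1≤x IB = Spans-translate _ (x ∸ 1) 0 B IB (λ _ _ → +-identityʳ _) (trans (+-identityʳ x) (sym (m+[n∸m]≡n 1≤x)))

Every-Good-raise : ∀ B x → Every Good B → Every Good (raise x B)
Every-Good-raise B x gB = Every-Good-translate _ (x ∸ 1) 0 B gB (λ _ _ → +-identityʳ _)

ComposeResult : ℕ → Tree → Set
ComposeResult n T = Every Good T × Spans T 1 n

label-position : ∀ A x {n} → Spans A 1 n → 0 < occ A x → 1 ≤ x × occ A x ≡ 1
label-position A x {n} IA Ax-pos = proj₁ (χ-pos⇒inside pos) , trans (IA x) (χ-pos⇒1 pos)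
  where
  pos : 0 < χ 1 n x
  pos = subst (0 <_) (IA x) Ax-pos

Spans-inserted : ∀ A r x {n k} → Spans A 1 n → 0 < occ A x → Bump.Inserted x k A r → Spans r 1 (n + suc k ∸ 1)
Spans-inserted A r x {n} {k} IA Ax-pos E =
  subst (Spans r 1) (sym (cong (_∸ 1) (+-suc n k))) (Bump.Spans-insert x k A r IA (proj₂ (label-position A x IA Ax-pos)) E)

Substitution⇒Result : ∀ A x {n k r} → Spans A 1 n → 0 < occ A x → Bump.Substitution x k A r
                    → ComposeResult (n + suc k ∸ 1) r
Substitution⇒Result A x {r = r} IA Ax-pos σ = Bump.everyGood σ , Spans-inserted A r x IA Ax-pos (Bump.inserted σ)

Good-substW : ∀ A B x {n k} → Every Good A → Every Good B → Spans A 1 n → Spans B 1 (suc k) → 0 < occ A x → isRed B ≡ false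
            → ComposeResult (n + suc k ∸ 1) (substW x (rootLabels (raise x B)) (children (raise x B)) (mapLabels (bump x (suc k)) A))
Good-substW A B@(node _ _) x {k = k} gA gB IA IB Ax-pos B-white = Substitution⇒Result A x IA Ax-pos σ
  where
  position : 1 ≤ x × occ A x ≡ 1
  position = label-position A x IA Ax-pos
  open SubstitutionW x k (rootLabels (raise x B)) (children (raise x B))
         (Every-Good-raise B x gB) (trans (isRed-mapLabels _ B) B-white) (Spans-raise B x (proj₁ position) IB)
  σ : Substitution A (substW x (rootLabels (raise x B)) (children (raise x B)) (mapLabels up A))
  σ = substW-up A gA (proj₂ position)

Good-substR : ∀ A B x {n k} → Every Good A → Every Good B → Spans A 1 n → Spans B 1 (suc k) → 0 < occ A x
            → isRed B ≡ true → isSoleLeaf x A ≡ false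
            → ComposeResult (n + suc k ∸ 1) (substR x (raise x B) (mapLabels (bump x (suc k)) A))
Good-substR A B@(node [] csB) x {k = k} gA gB IA IB Ax-pos B-red not-sole = Substitution⇒Result A x IA Ax-pos σ
  where
  position : 1 ≤ x × occ A x ≡ 1
  position = label-position A x IA Ax-pos
  open SubstitutionR x k (children (raise x B))
         (Every-Good-raise B x gB) (trans (allWhite-mapLabelsF _ csB) B-red) (Spans-raise B x (proj₁ position) IB)
  σ : Substitution A (substR x (raise x B) (mapLabels up A))
  σ = substR-up A gA (proj₂ position) (Bump.isSoleLeaf-up x k A not-sole)

Good-raise-unit : ∀ A B x {n k} → Every Good B → Spans A 1 n → Spans B 1 k → 0 < occ A x → isSoleLeaf x A ≡ true
                → ComposeResult (n + k ∸ 1) (raise x B)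
Good-raise-unit A B x {n} {k} gB IA IB Ax-pos sole = Every-Good-raise B x gB , subst₂ (Spans (raise x B)) x≡1 k≡ (Spans-raise B x 1≤x IB)
  where
  n≡1 : n ≡ 1
  n≡1 = trans (sym (weight-Spans A IA)) (cong weight (sole-leaf A sole))
  x-pos : 0 < χ 1 n x
  x-pos = subst (0 <_) (IA x) Ax-pos
  1≤x : 1 ≤ x
  1≤x = proj₁ (χ-pos⇒inside x-pos)
  x≡1 : x ≡ 1
  x≡1 = ≤-antisym (≤-pred (subst (x <_) (cong suc n≡1) (proj₂ (χ-pos⇒inside x-pos)))) 1≤x
  k≡ : k ≡ n + k ∸ 1
  k≡ rewrite n≡1 = refl

Good-compose : ∀ A B x {n k} → Every Good A → Every Good B → Spans A 1 n → Spans B 1 k → 0 < occ A x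
             → ComposeResult (n + k ∸ 1) (compose A x B)
Good-compose A B x {k = zero} _ gB _ IB _ = ⊥-elim (<⇒≱ (weight-pos B gB) (≤-reflexive (weight-Spans B IB)))
-- Abstracting the two tests inside compose makes the goal reduce to the relevant case.
Good-compose A B x {n} {suc k} gA gB IA IB Ax-pos with isRed B in B-colour | isSoleLeaf x A in sole
... | false | _ = subst (ComposeResult (n + suc k ∸ 1)) (sym (cong substW-A B-weight))
                        (Good-substW A B x gA gB IA IB Ax-pos B-colour)
  where
  B-weight : weight B ≡ suc k
  B-weight = weight-Spans B IB
  substW-A : ℕ → Tree
  substW-A w = substW x (rootLabels (raise x B)) (children (raise x B)) (mapLabels (bump x w) A)
... | true | false = subst (ComposeResult (n + suc k ∸ 1)) (sym (cong substR-A B-weight))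
                           (Good-substR A B x gA gB IA IB Ax-pos B-colour sole)
  where
  B-weight : weight B ≡ suc k
  B-weight = weight-Spans B IB
  substR-A : ℕ → Tree
  substR-A w = substR x (raise x B) (mapLabels (bump x w) A)
... | true | true = Good-raise-unit A B x gB IA IB Ax-pos sole

Every-Good-leaf : ∀ i → Every Good (leaf i)
Every-Good-leaf i = every (good (λ ()) (i , 1 , λ y → mult-range y i 1) (s≤s z≤n) (inj₂ []) (λ _ → z≤n)) []

soundness : ∀ {T} → InBWS T → Σ ℕ (Spans T 1) × Every Good T
soundness unit = (1 , (λ y → mult-range y 1 1)) , Every-Good-leaf 1
soundness gen₁ = (2 , I) , every (good (λ ()) (1 , 2 , I) (s≤s z≤n) (inj₂ (refl ∷ [])) (λ _ → z≤n)) (Every-Good-leaf 1 ∷ [])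
  where
  I : Spans (node (2 ∷ []) (leaf 1 ∷ [])) 1 2
  I = ↭⇒Spans (node (2 ∷ []) (leaf 1 ∷ [])) (swap 2 1 ↭-refl)
soundness gen₂ = (2 , (λ y → mult-range y 1 2))
  , every (good (λ ()) (1 , 2 , (λ y → mult-range y 1 2)) (s≤s z≤n) (inj₂ (refl ∷ [])) (λ _ → z≤n)) (Every-Good-leaf 2 ∷ [])
soundness gen₃ = (2 , (λ y → mult-range y 1 2))
  , every (good (λ _ → s≤s (s≤s z≤n)) (1 , 2 , (λ y → mult-range y 1 2)) z≤n (inj₁ refl) (λ ())) (Every-Good-leaf 1 ∷ Every-Good-leaf 2 ∷ [])
soundness (comp {T₁} {T₂} {x} p q x∈T₁) with soundness p | soundness q
... | (n , I₁) , g₁ | (k , I₂) , g₂ with Good-compose T₁ T₂ x g₁ g₂ I₁ I₂ (∈⇒mult-pos x∈T₁)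
... | g , I = (n + k ∸ 1 , I) , g
soundness (iso p i) with soundness p
... | (n , I) , g = (n , λ y → trans (sym (↭⇒mult (≅⇒labels-↭ i) y)) (I y)) , Every-Good-≅ i g

-- Corollas

mutual
  ≅-refl : ∀ t → t ≅ t
  ≅-refl (node L cs) = node≅ ↭-refl (perm ↭-refl (≅P-refl cs))

  ≅P-refl : ∀ cs → cs ≅P cs
  ≅P-refl [] = []
  ≅P-refl (c ∷ cs) = ≅-refl c ∷ ≅P-refl cs

≅-children : ∀ L {cs ds} → cs ↭ ds → node L cs ≅ node L ds
≅-children L {ds = ds} p = node≅ ↭-refl (perm p (≅P-refl ds))

++-∷ʳ-↭ : ∀ {A : Set} (as bs : List A) c → (as ++ bs) ++ c ∷ [] ↭ as ++ c ∷ bs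
++-∷ʳ-↭ as bs c = ↭-trans (↭-reflexive (++-assoc as bs (c ∷ []))) (++⁺ˡ as (↭-sym (∷↭∷ʳ c bs)))

redCorolla : ℕ → Tree
redCorolla n = node [] (map leaf (range 1 n))

substRF-leaves : ∀ x S l → All (_< x) l → substRF x S (map leaf l ++ leaf x ∷ []) ≡ map leaf l ++ children S
substRF-leaves x S [] [] rewrite ≡ᵇ-refl x = ++-identityʳ (children S)
substRF-leaves x S (v ∷ l) (v<x ∷ l<x) rewrite ≡ᵇ-≢ (<⇒≢ v<x) = cong (leaf v ∷_) (substRF-leaves x S l l<x)

InBWS-redCorolla : ∀ m → InBWS (redCorolla (2 + m))
InBWS-redCorolla zero = gen₃
InBWS-redCorolla (suc m) = subst InBWS composite≡ (comp (InBWS-redCorolla m) gen₃ x∈)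
  where
  x : ℕ
  x = 2 + m
  open Bump x 1 using (up)
  labels≡ : labels (redCorolla x) ≡ range 1 x
  labels≡ = labelsF-leaves (range 1 x)
  x∈ : x ∈ labels (redCorolla x)
  x∈ = mult-pos⇒∈ (subst (0 <_) (sym (trans (cong (mult x) labels≡) (mult-range x 1 x))) (≤-reflexive (sym (χ-inside (s≤s z≤n) ≤-refl))))
  fixed : mapLabels up (redCorolla x) ≡ redCorolla x
  fixed = mapLabels-id-on up (redCorolla x)
    (λ y py → bump-≤ (≤-pred (proj₂ (χ-pos⇒inside (subst (0 <_) (trans (cong (mult y) labels≡) (mult-range y 1 x)) py)))))
  below : All (_< x) (range 1 (suc m))
  below = All.map proj₂ (range-bounds 1 (suc m))
  S = node [] (leaf x ∷ leaf (suc x) ∷ [])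
  composite≡ : compose (redCorolla x) x (node [] (leaf 1 ∷ leaf 2 ∷ [])) ≡ redCorolla (suc x)
  composite≡ = begin
    substR x S (mapLabels up (redCorolla x))                     ≡⟨ cong (substR x S) fixed ⟩
    node [] (substRF x S (map leaf (range 1 x)))                 ≡⟨ cong (λ l → node [] (substRF x S (map leaf l))) (range-∷ʳ 1 (suc m)) ⟩
    node [] (substRF x S (map leaf (range 1 (suc m) ++ x ∷ []))) ≡⟨ cong (λ l → node [] (substRF x S l)) (map-++ leaf (range 1 (suc m)) (x ∷ [])) ⟩
    node [] (substRF x S (map leaf (range 1 (suc m)) ++ leaf x ∷ [])) ≡⟨ cong (node []) (substRF-leaves x S (range 1 (suc m)) below) ⟩
    node [] (map leaf (range 1 (suc m)) ++ leaf x ∷ leaf (suc x) ∷ []) ≡⟨ cong (node []) (sym (map-++ leaf (range 1 (suc m)) (x ∷ suc x ∷ []))) ⟩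
    node [] (map leaf (range 1 (suc m) ++ x ∷ suc x ∷ []))       ≡⟨ cong (λ l → node [] (map leaf l)) (sym (trans (cong (range 1) (+-comm 2 (suc m))) (range-++ 1 (suc m) 2))) ⟩
    redCorolla (suc x)                                           ∎
    where open ≡-Reasoning

corolla : ℕ → ℕ → Tree
corolla p q = node (suc p ∷ []) (map leaf (range 1 p ++ range (2 + p) q))

corolla-bumped : ∀ p q → mapLabels (bump (suc p) 2) (corolla p q) ≡ node (suc p ∷ []) (map leaf (range 1 p ++ range (3 + p) q))
corolla-bumped p q = cong₂ (λ a cs → node (a ∷ []) cs) (bump-≤ ≤-refl)
  (trans (mapLabelsF-leaves up (range 1 p ++ range (2 + p) q))
  (cong (map leaf) (trans (map-++ up (range 1 p) (range (2 + p) q))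
     (cong₂ _++_ (map-id-local (All.map (λ (_ , v<1+p) → bump-≤ (<⇒≤ v<1+p)) (range-bounds 1 p)))
                 (trans (map-cong-local (All.map (λ {v} (1+p<v , _) → trans (bump-> 1+p<v) (+-comm v 1)) (range-bounds (2 + p) q)))
                        (map-+-range 1 (2 + p) q))))))
  where open Bump (suc p) 1 using (up)

corolla-grow-right : ∀ p q → InBWS (corolla p q) → InBWS (corolla p (suc q))
corolla-grow-right p q ih = iso (subst InBWS composite≡ (comp ih gen₂ (here refl))) (≅-children (suc p ∷ []) leaves↭)
  where
  lo hi : List ℕ
  lo = range 1 p
  hi = range (3 + p) q
  composite≡ : compose (corolla p q) (suc p) (node (1 ∷ []) (leaf 2 ∷ [])) ≡ node (suc p ∷ []) (map leaf (lo ++ hi) ++ leaf (2 + p) ∷ [])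
  composite≡ = trans (cong (substW (suc p) (suc p ∷ []) (leaf (2 + p) ∷ [])) (corolla-bumped p q))
                     (substW-at-root (suc p) (suc p ∷ []) (leaf (2 + p) ∷ []) (map leaf (lo ++ hi)))
  leaves↭ : map leaf (lo ++ hi) ++ leaf (2 + p) ∷ [] ↭ map leaf (lo ++ 2 + p ∷ hi)
  leaves↭ rewrite map-++ leaf lo hi | map-++ leaf lo (2 + p ∷ hi) = ++-∷ʳ-↭ (map leaf lo) (map leaf hi) (leaf (2 + p))

corolla-grow-left : ∀ p q → InBWS (corolla p q) → InBWS (corolla (suc p) q)
corolla-grow-left p q ih = iso (subst InBWS composite≡ (comp ih gen₁ (here refl))) (≅-children (2 + p ∷ []) leaves↭)
  where
  lo hi : List ℕ
  lo = range 1 p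
  hi = range (3 + p) q
  composite≡ : compose (corolla p q) (suc p) (node (2 ∷ []) (leaf 1 ∷ [])) ≡ node (2 + p ∷ []) (map leaf (lo ++ hi) ++ leaf (suc p) ∷ [])
  composite≡ = trans (cong (substW (suc p) (2 + p ∷ []) (leaf (suc p) ∷ [])) (corolla-bumped p q))
                     (substW-at-root (suc p) (2 + p ∷ []) (leaf (suc p) ∷ []) (map leaf (lo ++ hi)))
  leaves↭ : map leaf (lo ++ hi) ++ leaf (suc p) ∷ [] ↭ map leaf (range 1 (suc p) ++ hi)
  leaves↭ = ↭-trans (↭-reflexive (cong (_++ leaf (suc p) ∷ []) (map-++ leaf lo hi)))
            (↭-trans (++-∷ʳ-↭ (map leaf lo) (map leaf hi) (leaf (suc p)))
            (↭-reflexive (begin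
              map leaf lo ++ leaf (suc p) ∷ map leaf hi   ≡⟨ sym (++-assoc (map leaf lo) (leaf (suc p) ∷ []) (map leaf hi)) ⟩
              (map leaf lo ++ leaf (suc p) ∷ []) ++ map leaf hi ≡⟨ cong (_++ map leaf hi) (sym (map-++ leaf lo (suc p ∷ []))) ⟩
              map leaf (lo ++ suc p ∷ []) ++ map leaf hi  ≡⟨ sym (map-++ leaf (lo ++ suc p ∷ []) hi) ⟩
              map leaf ((lo ++ suc p ∷ []) ++ hi)         ≡⟨ cong (λ l → map leaf (l ++ hi)) (sym (range-∷ʳ 1 p)) ⟩
              map leaf (range 1 (suc p) ++ hi)            ∎)))
    where open ≡-Reasoning

InBWS-corolla : ∀ p q → InBWS (corolla p q)
InBWS-corolla zero zero = unit
InBWS-corolla zero (suc q) = corolla-grow-right 0 q (InBWS-corolla 0 q)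
InBWS-corolla (suc p) q = corolla-grow-left p q (InBWS-corolla p q)

heavy-child? : ∀ cs → (Σ (List Tree) λ pre → Σ Tree λ c → Σ (List Tree) λ post → cs ≡ pre ++ c ∷ post × 2 ≤ weight c)
                   ⊎ All (λ c → weight c ≤ 1) cs
heavy-child? [] = inj₂ []
heavy-child? (c ∷ cs) with 2 ≤? weight c | heavy-child? cs
... | yes heavy | _ = inj₁ ([] , c , cs , refl , heavy)
... | no _ | inj₁ (pre , c' , post , refl , heavy) = inj₁ (c ∷ pre , c' , post , refl , heavy)
... | no light | inj₂ lights = inj₂ (≤-pred (≰⇒> light) ∷ lights)

light⇒leaf : ∀ c → Every Good c → weight c ≤ 1 → Σ ℕ λ l → c ≡ leaf l
light⇒leaf (node (v ∷ []) []) _ _ = v , refl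
light⇒leaf (node (_ ∷ _ ∷ _) _) (every g _) _ with atMostOneLabel g
... | s≤s ()
light⇒leaf (node (_ ∷ []) (c ∷ cs)) (every _ (g ∷ _)) (s≤s w≤0)
  with ≤-trans (≤-trans (weight-pos c g) (subst (weight c ≤_) (sym (length-++ (labels c))) (m≤m+n _ _))) w≤0
... | ()
light⇒leaf (node [] []) (every g _) _ with twoChildren g refl
... | ()
light⇒leaf (node [] (_ ∷ [])) (every g _) _ with twoChildren g refl
... | s≤s ()
light⇒leaf (node [] (c₁ ∷ c₂ ∷ cs)) (every _ (g₁ ∷ g₂ ∷ _)) w≤1 =
  ⊥-elim (<⇒≱ (s≤s (≤-trans (+-mono-≤ (weight-pos c₁ g₁) (weight-pos c₂ g₂)) two-weights)) (s≤s w≤1))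
  where
  two-weights : weight c₁ + weight c₂ ≤ weight (node [] (c₁ ∷ c₂ ∷ cs))
  two-weights rewrite length-++ (labels c₁) {labelsF (c₂ ∷ cs)} | length-++ (labels c₂) {labelsF cs} =
    +-monoʳ-≤ (weight c₁) (m≤m+n _ _)

light⇒leaves : ∀ cs → All (Every Good) cs → All (λ c → weight c ≤ 1) cs → Σ (List ℕ) λ ls → cs ≡ map leaf ls
light⇒leaves [] [] [] = [] , refl
light⇒leaves (c ∷ cs) (g ∷ gs) (w ∷ ws) with light⇒leaf c g w | light⇒leaves cs gs ws
... | l , refl | ls , refl = l ∷ ls , refl

InBWS-red-corolla : ∀ ls {n} → Spans (node [] (map leaf ls)) 1 n → 2 ≤ length (map leaf ls) → InBWS (node [] (map leaf ls))
InBWS-red-corolla ls {n} I two = from-range n ls↭ (subst (2 ≤_) (trans (length-map leaf ls) (trans (↭-length ls↭) (length-range 1 n))) two)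
  where
  ls↭ : ls ↭ range 1 n
  ls↭ = subst (_↭ range 1 n) (labelsF-leaves ls) (Spans⇒↭ (node [] (map leaf ls)) I)
  from-range : ∀ n → ls ↭ range 1 n → 2 ≤ n → InBWS (node [] (map leaf ls))
  from-range (suc (suc m)) p _ = iso (InBWS-redCorolla m) (≅-children [] (map⁺ leaf (↭-sym p)))
  from-range (suc zero) _ (s≤s ())

InBWS-labelled-corolla : ∀ b ls {n} → Spans (node (b ∷ []) (map leaf ls)) 1 n → InBWS (node (b ∷ []) (map leaf ls))
InBWS-labelled-corolla b ls {n} I with χ-pos⇒inside {1} {n} {b} (subst (0 <_) (I b) (mult-∷-self b (labelsF (map leaf ls))))
InBWS-labelled-corolla (suc p) ls {n} I | _ , p<n = iso (InBWS-corolla p q) (≅-children (suc p ∷ []) (map⁺ leaf (↭-sym ls↭)))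
  where
  q : ℕ
  q = n ∸ suc p
  n≡ : n ≡ p + suc q
  n≡ = trans (sym (m+[n∸m]≡n {suc p} {n} (≤-pred p<n))) (sym (+-suc p q))
  ls↭ : ls ↭ range 1 p ++ range (2 + p) q
  ls↭ = mult⇒↭ ls _ (λ y → +-cancelˡ-≡ (δ (suc p) y) _ _ (begin
    δ (suc p) y + mult y ls                             ≡⟨ cong (λ l → δ (suc p) y + mult y l) (sym (labelsF-leaves ls)) ⟩
    occ (node (suc p ∷ []) (map leaf ls)) y             ≡⟨ I y ⟩
    χ 1 n y                                             ≡⟨ sym (mult-range y 1 n) ⟩
    mult y (range 1 n)                                  ≡⟨ cong (λ w → mult y (range 1 w)) n≡ ⟩
    mult y (range 1 (p + suc q))                        ≡⟨ cong (mult y) (range-++ 1 p (suc q)) ⟩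
    mult y (range 1 p ++ range (suc p) (suc q))         ≡⟨ mult-++ y (range 1 p) (range (suc p) (suc q)) ⟩
    mult y (range 1 p) + (δ (suc p) y + mult y (range (2 + p) q)) ≡⟨ x∙yz≈y∙xz +-commutativeSemigroup (mult y (range 1 p)) (δ (suc p) y) (mult y (range (2 + p) q)) ⟩
    δ (suc p) y + (mult y (range 1 p) + mult y (range (2 + p) q)) ≡⟨ cong (δ (suc p) y +_) (sym (mult-++ y (range 1 p) _)) ⟩
    δ (suc p) y + mult y (range 1 p ++ range (2 + p) q) ∎))
    where open ≡-Reasoning

-- Contracting the block [x, x + k] to the single label x

module Contract (x k n : ℕ) (1≤x : 1 ≤ x) (x+k≤n : x + k ≤ n) where
  open Bump x k using (up)

  down : ℕ → ℕ
  down y = if x <ᵇ y then y ∸ k else y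

  down-≤ : ∀ {y} → y ≤ x → down y ≡ y
  down-≤ {y} y≤x with x <ᵇ y in e
  ... | true = ⊥-elim (<⇒≱ (<ᵇ⇒< x y (subst T (sym e) tt)) y≤x)
  ... | false = refl

  down-> : ∀ {y} → x < y → down y ≡ y ∸ k
  down-> {y} x<y with x <ᵇ y in e
  ... | true = refl
  ... | false = ⊥-elim (subst T e (<⇒<ᵇ x<y))

  x≤n∸k : x ≤ n ∸ k
  x≤n∸k = m+n≤o⇒m≤o∸n x x+k≤n

  -- U spans [1, n] once x is replaced by the block [x, x + k]
  Contracted : Tree → Set
  Contracted U = ∀ w → occ U w + χ x (suc k) w ≡ χ 1 n w + δ x w

  module Contraction (U : Tree) (C : Contracted U) where
    open ≡-Reasoning

    outside-block : ∀ y → 0 < occ U y → y ≤ x ⊎ x + k < y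
    outside-block y py with y ≤? x | y ≤? x + k
    ... | yes y≤x | _ = inj₁ y≤x
    ... | no _ | no y≰x+k = inj₂ (≰⇒> y≰x+k)
    ... | no y≰x | yes y≤x+k = ⊥-elim (<⇒≱ (+-monoˡ-≤ 1 py) (subst (_≤ 1) (sym U+1≡χ) (χ≤1 1 n y)))
      where
      U+1≡χ : occ U y + 1 ≡ χ 1 n y
      U+1≡χ = trans (cong (occ U y +_) (sym (χ-inside (<⇒≤ (≰⇒> y≰x)) (subst (y <_) (sym (+-suc x k)) (s≤s y≤x+k)))))
                    (trans (C y) (trans (cong (χ 1 n y +_) (δ-≢ (<⇒≢ (≰⇒> y≰x)))) (+-identityʳ _)))

    up∘down : mapLabels up (mapLabels down U) ≡ U
    up∘down = trans (mapLabels-∘ up down U) (mapLabels-id-on (up ∘ down) U up-down)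
      where
      up-down : ∀ y → 0 < occ U y → up (down y) ≡ y
      up-down y py with outside-block y py
      ... | inj₁ y≤x = trans (cong up (down-≤ y≤x)) (bump-≤ y≤x)
      ... | inj₂ x+k<y = trans (cong up (down-> (≤-trans (m≤m+n (suc x) k) x+k<y)))
                               (trans (bump-> (m+n≤o⇒m≤o∸n (suc x) x+k<y)) (m∸n+n≡m (≤-trans (m≤n+m k (suc x)) x+k<y)))

    occ-down-≤ : ∀ {z} → z ≤ x → occ (mapLabels down U) z ≡ occ U z
    occ-down-≤ {z} z≤x = occ-mapLabels-hit down U (down-≤ z≤x) fibre
      where
      fibre : ∀ v → 0 < occ U v → down v ≡ z → v ≡ z
      fibre v pv e with outside-block v pv
      ... | inj₁ v≤x = trans (sym (down-≤ v≤x)) e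
      ... | inj₂ x+k<v = ⊥-elim (<⇒≱ (≤-<-trans z≤x (m+n≤o⇒m≤o∸n (suc x) x+k<v))
                                      (≤-reflexive (trans (sym (down-> (≤-trans (m≤m+n (suc x) k) x+k<v))) e)))

    occ-down-> : ∀ {z} → x < z → occ (mapLabels down U) z ≡ occ U (z + k)
    occ-down-> {z} x<z = occ-mapLabels-hit down U down-w fibre
      where
      down-w : down (z + k) ≡ z
      down-w = trans (down-> (≤-<-trans (m≤m+n x k) (+-monoˡ-< k x<z))) (m+n∸n≡m z k)
      fibre : ∀ v → 0 < occ U v → down v ≡ z → v ≡ z + k
      fibre v pv e with outside-block v pv
      ... | inj₁ v≤x = ⊥-elim (<⇒≱ x<z (subst (_≤ x) (trans (sym (down-≤ v≤x)) e) v≤x))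
      ... | inj₂ x+k<v = trans (sym (m∸n+n≡m (≤-trans (m≤n+m k (suc x)) x+k<v)))
                               (cong (_+ k) (trans (sym (down-> (≤-trans (m≤m+n (suc x) k) x+k<v))) e))

    occ-below : ∀ {z} → z < x → occ U z ≡ χ 1 (n ∸ k) z
    occ-below {z} z<x = +-cancelʳ-≡ 0 (occ U z) _ (begin
      occ U z + 0             ≡⟨ cong (occ U z +_) (sym (χ-below z<x)) ⟩
      occ U z + χ x (suc k) z ≡⟨ C z ⟩
      χ 1 n z + δ x z         ≡⟨ cong (χ 1 n z +_) (δ-≢ (>⇒≢ z<x)) ⟩
      χ 1 n z + 0             ≡⟨ cong (_+ 0) (χ-resize (≤-<-trans (<⇒≤ z<x) (≤-<-trans (≤-trans (m≤m+n x k) x+k≤n) (n<1+n n)))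
                                                       (s≤s (≤-trans (<⇒≤ z<x) x≤n∸k))) ⟩
      χ 1 (n ∸ k) z + 0       ∎)

    occ-x : occ U x ≡ χ 1 (n ∸ k) x
    occ-x = +-cancelʳ-≡ 1 (occ U x) _ (begin
      occ U x + 1             ≡⟨ cong (occ U x +_) (sym (χ-inside ≤-refl (m<m+n x (s≤s z≤n)))) ⟩
      occ U x + χ x (suc k) x ≡⟨ C x ⟩
      χ 1 n x + δ x x         ≡⟨ cong₂ _+_ (χ-inside 1≤x (s≤s (≤-trans (m≤m+n x k) x+k≤n))) (δ-refl x) ⟩
      1 + 1                   ≡⟨ cong (_+ 1) (sym (χ-inside 1≤x (s≤s x≤n∸k))) ⟩
      χ 1 (n ∸ k) x + 1       ∎)

    occ-above : ∀ {z} → x < z → occ U (z + k) ≡ χ 1 (n ∸ k) z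
    occ-above {z} x<z = +-cancelʳ-≡ 0 (occ U w) _ (begin
      occ U w + 0             ≡⟨ cong (occ U w +_) (sym (χ-above (subst (_≤ w) (sym (+-suc x k)) x+k<w))) ⟩
      occ U w + χ x (suc k) w ≡⟨ C w ⟩
      χ 1 n w + δ x w         ≡⟨ cong (χ 1 n w +_) (δ-≢ (<⇒≢ (≤-<-trans (m≤m+n x k) x+k<w))) ⟩
      χ 1 n w + 0             ≡⟨ cong (λ m → χ 1 m w + 0) (sym (m∸n+n≡m (≤-trans (m≤n+m k x) x+k≤n))) ⟩
      χ 1 (n ∸ k + k) w + 0   ≡⟨ cong (_+ 0) (sym (χ-stretch (≤-trans 1≤x (<⇒≤ x<z)))) ⟩
      χ 1 (n ∸ k) z + 0       ∎)
      where
      w : ℕ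
      w = z + k
      x+k<w : x + k < w
      x+k<w = +-monoˡ-< k x<z

    spans : Spans (mapLabels down U) 1 (n ∸ k)
    spans z with <-cmp z x
    ... | tri< z<x _ _ = trans (occ-down-≤ (<⇒≤ z<x)) (occ-below z<x)
    ... | tri≈ _ refl _ = trans (occ-down-≤ ≤-refl) occ-x
    ... | tri> _ _ x<z = trans (occ-down-> x<z) (occ-above x<z)

  up∘down : ∀ U → Contracted U → mapLabels up (mapLabels down U) ≡ U
  up∘down U C = Contraction.up∘down U C

  Spans-down : ∀ U → Contracted U → Spans (mapLabels down U) 1 (n ∸ k)
  Spans-down U C = Contraction.spans U C

  no-label-across : ∀ t → Every Good t → (∀ y → 0 < occ t y → y < x ⊎ x + k < y)
                  → ∀ {y z} → 0 < occ t y → 0 < occ t z → y < x → x < z → ⊥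
  no-label-across t g avoids {y} {z} py pz y<x x<z = x-avoided (avoids x tx-pos)
    where
    ι : IsInterval t
    ι = interval (Every-root g)
    I : Spans t (proj₁ ι) (proj₁ (proj₂ ι))
    I = proj₂ (proj₂ ι)
    tx-pos : 0 < occ t x
    tx-pos = subst (0 <_) (sym (trans (I x) (χ-inside (≤-trans (proj₁ (χ-pos⇒inside (subst (0 <_) (I y) py))) (<⇒≤ y<x))
                                                      (<-trans x<z (proj₂ (χ-pos⇒inside (subst (0 <_) (I z) pz)))))))
                   (s≤s z≤n)
    x-avoided : x < x ⊎ x + k < x → ⊥
    x-avoided (inj₁ x<x) = <-irrefl refl x<x
    x-avoided (inj₂ x+k<x) = <⇒≱ x+k<x (m≤m+n x k)

  Every-Good-down : ∀ t → Every Good t → (∀ y → 0 < occ t y → y < x ⊎ x + k < y) → Every Good (mapLabels down t)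
  Every-Good-down t g avoids with some-label t g
  ... | y₀ , py₀ with avoids y₀ py₀
  ... | inj₁ y₀<x = Every-Good-translate down 0 0 t g below
    where
    below : ∀ y → 0 < occ t y → down y + 0 ≡ y + 0
    below y py with avoids y py
    ... | inj₁ y<x = cong (_+ 0) (down-≤ (<⇒≤ y<x))
    ... | inj₂ x+k<y = ⊥-elim (no-label-across t g avoids py₀ py y₀<x (≤-<-trans (m≤m+n x k) x+k<y))
  ... | inj₂ x+k<y₀ = Every-Good-translate down 0 k t g above
    where
    above : ∀ y → 0 < occ t y → down y + k ≡ y + 0
    above y py with avoids y py
    ... | inj₁ y<x = ⊥-elim (no-label-across t g avoids py py₀ y<x (≤-<-trans (m≤m+n x k) x+k<y₀))
    ... | inj₂ x+k<y = trans (cong (_+ k) (down-> (≤-<-trans (m≤m+n x k) x+k<y)))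
                             (trans (m∸n+n≡m (≤-trans (m≤n+m k x) (<⇒≤ x+k<y))) (sym (+-identityʳ y)))

  Every-Good-downF : ∀ cs → All (Every Good) cs → (∀ y → 0 < occF cs y → y < x ⊎ x + k < y) → All (Every Good) (mapLabelsF down cs)
  Every-Good-downF [] [] _ = []
  Every-Good-downF (c ∷ cs) (g ∷ gs) avoids =
    Every-Good-down c g (λ y py → avoids y (occF-head c cs py)) ∷ Every-Good-downF cs gs (λ y py → avoids y (occF-tail c cs py))

-- Decomposing along a heavy child

lower : ℕ → Tree → Tree
lower x c = mapLabels (λ y → y ∸ (x ∸ 1)) c

module Lower (c : Tree) (x m : ℕ) (1≤x : 1 ≤ x) (Ic : Spans c x m) where

  lower-raise : ∀ y → 0 < occ c y → y ∸ (x ∸ 1) + (x ∸ 1) ≡ y + 0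
  lower-raise y py = trans (m∸n+n≡m (≤-trans (m∸n≤m x 1) (proj₁ (χ-pos⇒inside (subst (0 <_) (Ic y) py))))) (sym (+-identityʳ y))

  Spans-lower : Spans (lower x c) 1 m
  Spans-lower = Spans-translate _ 0 (x ∸ 1) c Ic lower-raise (trans (m+[n∸m]≡n 1≤x) (sym (+-identityʳ x)))

  Every-Good-lower : Every Good c → Every Good (lower x c)
  Every-Good-lower g = Every-Good-translate _ 0 (x ∸ 1) c g lower-raise

  raise-lower : raise x (lower x c) ≡ c
  raise-lower = trans (mapLabels-∘ _ _ c) (mapLabels-id-on _ c (λ y py → trans (lower-raise y py) (+-identityʳ y)))

record Decomposition (T : Tree) (n : ℕ) : Set where
  field
    T₁ T₂     : Tree
    n₁ n₂ x   : ℕ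
    n₁<n      : n₁ < n
    n₂<n      : n₂ < n
    good₁     : Every Good T₁
    good₂     : Every Good T₂
    spans₁    : Spans T₁ 1 n₁
    spans₂    : Spans T₂ 1 n₂
    x∈T₁      : x ∈ labels T₁
    composite : compose T₁ x T₂ ≅ T

some-label-outside : ∀ L ds → (L ≡ [] → 1 ≤ length ds) → All (Every Good) ds → Σ ℕ λ y → 0 < mult y L + occF ds y
some-label-outside (v ∷ L) ds _ _ = v , ≤-trans (mult-∷-self v L) (m≤m+n _ _)
some-label-outside [] [] nonempty _ with nonempty refl
... | ()
some-label-outside [] (d ∷ ds) _ (g ∷ _) with some-label d g
... | y , py = y , occF-head d ds py

module Decompose (L : List ℕ) (pre post : List Tree) (c : Tree) (n x k : ℕ)
  (gT : Every Good (node L (pre ++ c ∷ post))) (I : Spans (node L (pre ++ c ∷ post)) 1 n)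
  (Ic : Spans c x (suc k)) (1≤k : 1 ≤ k) where

  cs : List Tree
  cs = pre ++ c ∷ post
  whole : Tree
  whole = node L cs
  gRoot : Good whole
  gRoot = Every-root gT
  gpre : All (Every Good) pre
  gpre = proj₁ (++⁻ pre (Every-children gT))

  gc : Every Good c
  gc with proj₂ (++⁻ pre (Every-children gT))
  ... | g ∷ _ = g

  gpost : All (Every Good) post
  gpost with proj₂ (++⁻ pre (Every-children gT))
  ... | _ ∷ gs = gs

  rest : ℕ → ℕ
  rest y = mult y L + occF (pre ++ post) y

  occ-whole : ∀ y → occ whole y ≡ occ c y + rest y
  occ-whole y rewrite occ-node L cs y | occF-++ y pre (c ∷ post) | occF-∷ c post y | occF-++ y pre post =
    solve 4 (λ l a cc b → l :+ (a :+ (cc :+ b)) := cc :+ (l :+ (a :+ b))) refl (mult y L) (occF pre y) (occ c y) (occF post y)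

  in-c⇒not-rest : ∀ y → occ c y ≡ 1 → rest y ≡ 0
  in-c⇒not-rest y cy≡1 = n≤0⇒n≡0 (≤-pred (subst (_≤ 1) (trans (trans (sym (I y)) (occ-whole y)) (cong (_+ rest y) cy≡1)) (χ≤1 1 n y)))

  block-in-c : ∀ y → x ≤ y → y ≤ x + k → occ c y ≡ 1
  block-in-c y x≤y y≤x+k = trans (Ic y) (χ-inside x≤y (subst (y <_) (sym (+-suc x k)) (s≤s y≤x+k)))

  c-label-in-range : ∀ y → occ c y ≡ 1 → 1 ≤ y × y ≤ n
  c-label-in-range y cy≡1 with χ-pos⇒inside (subst (0 <_) (trans (sym (occ-whole y)) (I y)) (≤-trans (≤-reflexive (sym cy≡1)) (m≤m+n _ _)))
  ... | 1≤y , y<1+n = 1≤y , ≤-pred y<1+n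

  1≤x : 1 ≤ x
  1≤x = proj₁ (c-label-in-range x (block-in-c x ≤-refl (m≤m+n x k)))

  x+k≤n : x + k ≤ n
  x+k≤n = proj₂ (c-label-in-range (x + k) (block-in-c (x + k) (m≤m+n x k) ≤-refl))

  rest-avoids-block : ∀ y → 0 < rest y → y < x ⊎ x + k < y
  rest-avoids-block y py with y <? x | x + k <? y
  ... | yes y<x | _ = inj₁ y<x
  ... | no _ | yes x+k<y = inj₂ x+k<y
  ... | no y≮x | no y≯x+k = ⊥-elim (<-irrefl (sym (in-c⇒not-rest y (block-in-c y (≮⇒≥ y≮x) (≮⇒≥ y≯x+k)))) py)

  rest-parts : ∀ y → rest y ≡ 0 → mult y L ≡ 0 × occF pre y ≡ 0 × occF post y ≡ 0
  rest-parts y e = let e' = trans (sym (occF-++ y pre post)) (m+n≡0⇒n≡0 _ e) in m+n≡0⇒m≡0 _ e , m+n≡0⇒m≡0 _ e' , m+n≡0⇒n≡0 _ e'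

  rest-avoids-pre : ∀ y → 0 < occF pre y → y < x ⊎ x + k < y
  rest-avoids-pre y p = rest-avoids-block y (≤-trans (subst (0 <_) (sym (occF-++ y pre post)) (≤-trans p (m≤m+n _ _))) (m≤n+m _ _))

  rest-avoids-post : ∀ y → 0 < occF post y → y < x ⊎ x + k < y
  rest-avoids-post y p = rest-avoids-block y (≤-trans (subst (0 <_) (sym (occF-++ y pre post)) (≤-trans p (m≤n+m _ _))) (m≤n+m _ _))

  siblings : L ≡ [] → 1 ≤ length (pre ++ post)
  siblings L≡[] rewrite length-++ pre {post} =
    ≤-pred (subst (2 ≤_) (trans (length-++ pre {c ∷ post}) (+-suc (length pre) (length post))) (twoChildren gRoot L≡[]))

  1+k<n : suc k < n
  1+k<n with some-label-outside L (pre ++ post) siblings (++⁺ gpre gpost)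
  ... | y , py with rest-in-range y py | χ-view x (suc k) y
    where
    rest-in-range : ∀ y → 0 < rest y → 1 ≤ y × y < 1 + n
    rest-in-range y py = χ-pos⇒inside (subst (0 <_) (trans (sym (occ-whole y)) (I y)) (≤-trans py (m≤n+m (rest y) (occ c y))))
  ... | _ | inj₁ (_ , _ , cy≡1) = ⊥-elim (<-irrefl (sym (in-c⇒not-rest y (trans (Ic y) cy≡1))) py)
  ... | 1≤y , _ | inj₂ (inj₁ y<x , _) = ≤-trans (+-monoˡ-≤ k (≤-trans (s≤s 1≤y) y<x)) x+k≤n
  ... | _ , y<1+n | inj₂ (inj₂ x+1+k≤y , _) = ≤-trans (≤-trans (+-monoˡ-≤ (suc k) 1≤x) x+1+k≤y) (≤-pred y<1+n)

  open Lower c x (suc k) 1≤x Ic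
  open Contract x k n 1≤x x+k≤n

  Contracted-from : ∀ U → (∀ w → occ U w ≡ δ x w + rest w) → Contracted U
  Contracted-from U occ-U w = begin
    occ U w + χ x (suc k) w         ≡⟨ cong₂ _+_ (occ-U w) (sym (Ic w)) ⟩
    δ x w + rest w + occ c w        ≡⟨ solve 3 (λ d o cc → d :+ o :+ cc := cc :+ o :+ d) refl (δ x w) (rest w) (occ c w) ⟩
    occ c w + rest w + δ x w        ≡⟨ cong (_+ δ x w) (trans (sym (occ-whole w)) (I w)) ⟩
    χ 1 n w + δ x w                 ∎
    where open ≡-Reasoning

  x∈down : ∀ U → Contracted U → x ∈ labels (mapLabels down U)
  x∈down U C = mult-pos⇒∈ (subst (0 <_) (sym (trans (Spans-down U C x) (χ-inside 1≤x (s≤s x≤n∸k)))) (s≤s z≤n))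

  decomposition-via : ∀ U → Contracted U → Every Good (mapLabels down U) → compose (mapLabels down U) x (lower x c) ≅ whole
                → Decomposition whole n
  decomposition-via U C g composite = record
    { T₁ = mapLabels down U ; T₂ = lower x c ; n₁ = n ∸ k ; n₂ = suc k ; x = x
    ; n₁<n = ∸-monoʳ-< 1≤k (≤-trans (m≤n+m k x) x+k≤n)
    ; n₂<n = 1+k<n
    ; good₁ = g ; good₂ = Every-Good-lower gc
    ; spans₁ = Spans-down U C ; spans₂ = Spans-lower
    ; x∈T₁ = x∈down U C
    ; composite = composite
    }

  bumped : ∀ U → Contracted U → mapLabels (bump x (weight (lower x c))) (mapLabels down U) ≡ U
  bumped U C = trans (cong (λ w → mapLabels (bump x w) (mapLabels down U)) (weight-Spans (lower x c) Spans-lower)) (up∘down U C)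

  decompose-white : isRed c ≡ false → Decomposition whole n
  decompose-white c-white = decomposition-via U C (every g' children-good) (subst (_≅ whole) (sym composite≡) (≅-refl whole))
    where
    U : Tree
    U = node L (pre ++ leaf x ∷ post)
    C : Contracted U
    C = Contracted-from U λ w → begin
      occ U w                                     ≡⟨ occ-node L (pre ++ leaf x ∷ post) w ⟩
      mult w L + occF (pre ++ leaf x ∷ post) w    ≡⟨ cong (mult w L +_) (occF-++ w pre (leaf x ∷ post)) ⟩
      mult w L + (occF pre w + occF (leaf x ∷ post) w) ≡⟨ cong (λ o → mult w L + (occF pre w + o)) (trans (occF-∷ (leaf x) post w) (cong (_+ occF post w) (occ-leaf x w))) ⟩
      mult w L + (occF pre w + (δ x w + occF post w)) ≡⟨ solve 4 (λ l a d b → l :+ (a :+ (d :+ b)) := d :+ (l :+ (a :+ b))) refl (mult w L) (occF pre w) (δ x w) (occF post w) ⟩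
      δ x w + (mult w L + (occF pre w + occF post w)) ≡⟨ cong (λ o → δ x w + (mult w L + o)) (sym (occF-++ w pre post)) ⟩
      δ x w + rest w                              ∎
      where open ≡-Reasoning
    same-colours : map isRed (mapLabelsF down (pre ++ leaf x ∷ post)) ≡ map isRed cs
    same-colours rewrite colours-mapLabelsF down (pre ++ leaf x ∷ post) | map-++ isRed pre (leaf x ∷ post) | map-++ isRed pre (c ∷ post) | c-white = refl
    g' : Good (node (map down L) (mapLabelsF down (pre ++ leaf x ∷ post)))
    g' = Good-recolour down L gRoot (SameColours⇒Compatible _ cs same-colours) (1 , n ∸ k , Spans-down U C)
    children-good : All (Every Good) (mapLabelsF down (pre ++ leaf x ∷ post))
    children-good = subst (All (Every Good)) (sym (trans (mapLabelsF-++ down pre (leaf x ∷ post)) (cong (λ v → mapLabelsF down pre ++ leaf v ∷ mapLabelsF down post) (down-≤ ≤-refl))))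
                          (++⁺ (Every-Good-downF pre gpre rest-avoids-pre) (Every-Good-leaf x ∷ Every-Good-downF post gpost rest-avoids-post))
    x-only-in-c : mult x L ≡ 0 × occF pre x ≡ 0 × occF post x ≡ 0
    x-only-in-c = rest-parts x (in-c⇒not-rest x (block-in-c x ≤-refl (m≤m+n x k)))
    composite≡ : compose (mapLabels down U) x (lower x c) ≡ whole
    composite≡ = begin
      compose (mapLabels down U) x (lower x c)
        ≡⟨ compose-white (mapLabels down U) x (lower x c) (trans (isRed-mapLabels _ c) c-white) ⟩
      substW x (rootLabels (raise x (lower x c))) (children (raise x (lower x c))) (mapLabels (bump x (weight (lower x c))) (mapLabels down U))
        ≡⟨ cong₂ (λ S U' → substW x (rootLabels S) (children S) U') raise-lower (bumped U C) ⟩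
      substW x (rootLabels c) (children c) U
        ≡⟨ substW-at-child x (rootLabels c) (children c) L pre post (proj₁ x-only-in-c) (proj₁ (proj₂ x-only-in-c)) (proj₂ (proj₂ x-only-in-c)) ⟩
      node L (pre ++ node (rootLabels c) (children c) ∷ post)
        ≡⟨ cong (λ t → node L (pre ++ t ∷ post)) (tree-η c) ⟩
      whole ∎
      where open ≡-Reasoning

  decompose-red : isRed c ≡ true → Decomposition whole n
  decompose-red c-red = decomposition-via U C (every g' (Every-Good-downF (pre ++ post) (++⁺ gpre gpost) rest-avoids))
                                      (subst (λ l → compose (mapLabels down U) x (lower x c) ≅ node l cs) (sym L≡[]) composite≅)
    where
    L≡[] : L ≡ []
    L≡[] = [ (λ e → e) , (λ cs-white → ⊥-elim (red-child⇒¬All-NotRed pre post c-red cs-white)) ]′ (noRedChild gRoot)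
    U : Tree
    U = node (x ∷ []) (pre ++ post)
    C : Contracted U
    C = Contracted-from U (λ w → cong (δ x w +_) (cong (λ l → mult w l + occF (pre ++ post) w) (sym L≡[])))
    rest-avoids : ∀ y → 0 < occF (pre ++ post) y → y < x ⊎ x + k < y
    rest-avoids y p = rest-avoids-block y (≤-trans p (m≤n+m _ _))
    whole-white : isRed whole ≡ false
    whole-white = trans (cong (λ l → isRed (node l cs)) L≡[])
                        (trans (allWhite-++ pre (c ∷ post)) (trans (cong (λ b → allWhite pre ∧ (not b ∧ allWhite post)) c-red) (∧-zeroʳ _)))
    one-red : redCount pre + suc (redCount post) ≤ 1
    one-red = subst (_≤ 1) (trans (redCount-++ pre (c ∷ post)) (cong (λ b → redCount pre + (if b then suc (redCount post) else redCount post)) c-red))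
                    (atMostOneRed gRoot whole-white)
    siblings-white : All NotRed (pre ++ post)
    siblings-white = redCount≡0⇒NotRed (pre ++ post)
      (trans (redCount-++ pre post) (n≤0⇒n≡0 (≤-pred (subst (_≤ 1) (+-suc (redCount pre) (redCount post)) one-red))))
    g' : Good (mapLabels down U)
    g' = good (λ ()) (1 , n ∸ k , Spans-down U C) (s≤s z≤n) (inj₂ (NotRed-mapLabelsF down siblings-white))
              (λ _ → subst (_≤ 1) (sym (trans (redCount-mapLabelsF down (pre ++ post)) (NotRed⇒redCount≡0 siblings-white))) z≤n)
    not-sole : ∀ ds → 1 ≤ length ds → isSoleLeaf x (node (down x ∷ []) (mapLabelsF down ds)) ≡ false
    not-sole (_ ∷ _) _ = refl
    composite≅ : compose (mapLabels down U) x (lower x c) ≅ node [] cs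
    composite≅ = subst (_≅ node [] cs) (sym composite≡) (≅-children [] (++-∷ʳ-↭ pre post c))
      where
      open ≡-Reasoning
      composite≡ : compose (mapLabels down U) x (lower x c) ≡ node [] ((pre ++ post) ++ c ∷ [])
      composite≡ = begin
        compose (mapLabels down U) x (lower x c)
          ≡⟨ compose-red (mapLabels down U) x (lower x c) (trans (isRed-mapLabels _ c) c-red) (not-sole (pre ++ post) (siblings L≡[])) ⟩
        substR x (raise x (lower x c)) (mapLabels (bump x (weight (lower x c))) (mapLabels down U))
          ≡⟨ cong₂ (substR x) raise-lower (bumped U C) ⟩
        substR x c U
          ≡⟨ substR-at-root x c (pre ++ post) ⟩
        node [] ((pre ++ post) ++ c ∷ []) ∎

decompose : ∀ L pre c post {n} → Every Good (node L (pre ++ c ∷ post)) → Spans (node L (pre ++ c ∷ post)) 1 n → 2 ≤ weight c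
          → Decomposition (node L (pre ++ c ∷ post)) n
decompose L pre c post {n} gT I heavy with proj₂ (++⁻ pre (Every-children gT))
... | gc ∷ _ with interval (Every-root gc)
... | a , m , Ic = by-size m Ic (subst (2 ≤_) (weight-Spans c Ic) heavy)
  where
  by-size : ∀ m → Spans c a m → 2 ≤ m → Decomposition (node L (pre ++ c ∷ post)) n
  by-size (suc (suc k)) Ic _ with isRed c in c-colour
  ... | false = Decompose.decompose-white L pre post c n a (suc k) gT I Ic (s≤s z≤n) c-colour
  ... | true = Decompose.decompose-red L pre post c n a (suc k) gT I Ic (s≤s z≤n) c-colour
  by-size (suc zero) _ (s≤s ())

InBWS-flat : ∀ L ls {n} → Good (node L (map leaf ls)) → Spans (node L (map leaf ls)) 1 n → InBWS (node L (map leaf ls))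
InBWS-flat [] ls g I = InBWS-red-corolla ls I (twoChildren g refl)
InBWS-flat (b ∷ []) ls _ I = InBWS-labelled-corolla b ls I
InBWS-flat (_ ∷ _ ∷ _) ls g I with atMostOneLabel g
... | s≤s ()

completeness : ∀ N T {n} → n ≤ N → Every Good T → Spans T 1 n → InBWS T
completeness zero T {n} n≤0 gT I = ⊥-elim (<⇒≱ (≤-trans (weight-pos T gT) (≤-reflexive (weight-Spans T I))) (≤-trans n≤0 z≤n))
completeness (suc N) (node L cs) n≤N gT I with heavy-child? cs
... | inj₂ lights with light⇒leaves cs (Every-children gT) lights
...   | ls , refl = InBWS-flat L ls (Every-root gT) I
completeness (suc N) (node L cs) n≤N gT I | inj₁ (pre , c , post , refl , heavy) =
  iso (comp (smaller T₁ n₁<n good₁ spans₁) (smaller T₂ n₂<n good₂ spans₂) x∈T₁) composite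
  where
  open Decomposition (decompose L pre c post gT I heavy)
  smaller : ∀ T' {m} → m < _ → Every Good T' → Spans T' 1 m → InBWS T'
  smaller T' m<n = completeness N T' (≤-pred (≤-trans m<n n≤N))

InBWS⇔Good : ∀ T → InBWS T ⇔ (Σ ℕ (Spans T 1) × Every Good T)
InBWS⇔Good T = mk⇔ soundness (λ ((n , I) , g) → completeness n T ≤-refl g I)

oneTo⇔Spans : ∀ T n → (labels T ↭ oneTo n) ⇔ Spans T 1 n
oneTo⇔Spans T n = mk⇔ (λ p → ↭⇒Spans T (subst (labels T ↭_) (map-+-upTo 1 n) p))
                      (λ I → subst (labels T ↭_) (sym (map-+-upTo 1 n)) (Spans⇒↭ T I))

Every-Good⇔ : ∀ T → Every Good T ⇔ (Every EmptyHasTwoChildren T × RecursivelyLabelled T × Every AtMostOneLabel T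
                                    × Every NoRedChildOfLabelled T × Every NoTwoRedChildrenOfWhite T)
Every-Good⇔ T = mk⇔
  (λ g → Every-map twoChildren g , Every-map (λ {t} g → Equivalence.from (SubtreeInterval⇔IsInterval t) (interval g)) g
       , Every-map atMostOneLabel g , Every-map noRedChild g , Every-map atMostOneRed g)
  (λ (two , rl , one , noRed , oneRed) →
     Every-map (λ {t} (two , rl , one , noRed , oneRed) → good two (Equivalence.to (SubtreeInterval⇔IsInterval t) rl) one noRed oneRed)
               (Every-zip two (Every-zip rl (Every-zip one (Every-zip noRed oneRed)))))

mainTheorem12 : (T : Tree) →
    InBWS T ⇔
      ((∃ λ n → IsRWTree n T)
       × RecursivelyLabelled T
       × Every AtMostOneLabel T
       × Every NoRedChildOfLabelled T
       × Every NoTwoRedChildrenOfWhite T)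
mainTheorem12 T = mk⇔
  (λ inBWS → let ((n , I) , g) = to (InBWS⇔Good T) inBWS ; (two , rest) = to (Every-Good⇔ T) g
             in (n , from (oneTo⇔Spans T n) I , two) , rest)
  (λ ((n , labels↭ , two) , rest) → from (InBWS⇔Good T) ((n , to (oneTo⇔Spans T n) labels↭) , from (Every-Good⇔ T) (two , rest)))
  where open Equivalence
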